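{- Let $L$ be either of the sequent calculi $\mathrm{lTS4}$ or $\mathrm{gTS4}$ defined in the context. Then $L$ has the subformula property: if a sequent $S$ is provable in $L$, then there is a proof $P$ of $S$ in $L$ such that every formula appearing in $P$ is a subformula of some formula in $S$.
   Context: Formulas are built from countably many propositional variables using the binary connectives $\wedge,\vee,\to$ and the unary connectives $\neg,\Box,\Diamond$; subformulas are defined as usual (the subformulas of $\neg\alpha$, $\Box\alpha$, $\Diamond\alpha$ are the formula itself and the subformulas of $\alpha$, etc.). Letters $\Gamma,\Delta$ (possibly with subscripts) denote finite, possibly empty, sets of formulas; a sequent is an expression $\Gamma\Rightarrow\Delta$; a comma denotes union. For a word $w$ over $\{\neg,\Box,\Diamond\}$, $w\Gamma=\{w\gamma:\gamma\in\Gamma\}$. A rule "$S_1;\dots;S_n\,/\,S$" has premises $S_1,\dots,S_n$ and conclusion $S$. The calculus lTS4. Initial sequents: for every propositional variable $p$: $p\Rightarrow p$, $\neg p\Rightarrow\neg p$, $\neg p,p\Rightarrow$, and $\Rightarrow\neg p,p$. Structural rules: (cut) $\Gamma\Rightarrow\alpha$; $\alpha,\Gamma\Rightarrow\Delta$ / $\Gamma\Rightarrow\Delta$. (we-left) $\Gamma\Rightarrow\Delta$ / $\alpha,\Gamma\Rightarrow\Delta$. (we-right) $\Gamma\Rightarrow\Delta$ / $\Gamma\Rightarrow\Delta,\alpha$. Non-twist logical rules: ($\wedge$left) $\alpha,\beta,\Gamma\Rightarrow\Delta$ / $\alpha\wedge\beta,\Gamma\Rightarrow\Delta$. ($\wedge$right)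 $\Gamma\Rightarrow\Delta,\alpha$; $\Gamma\Rightarrow\Delta,\beta$ / $\Gamma\Rightarrow\Delta,\alpha\wedge\beta$. ($\vee$left) $\alpha,\Gamma\Rightarrow\Delta$; $\beta,\Gamma\Rightarrow\Delta$ / $\alpha\vee\beta,\Gamma\Rightarrow\Delta$. ($\vee$right) $\Gamma\Rightarrow\Delta,\alpha,\beta$ / $\Gamma\Rightarrow\Delta,\alpha\vee\beta$. ($\to$left) $\Gamma\Rightarrow\Delta,\alpha$; $\beta,\Gamma\Rightarrow\Delta$ / $\alpha\to\beta,\Gamma\Rightarrow\Delta$. ($\to$right) $\alpha,\Gamma\Rightarrow\Delta,\beta$ / $\Gamma\Rightarrow\Delta,\alpha\to\beta$. ($\Box$left) $\alpha,\Gamma\Rightarrow\Delta$ / $\Box\alpha,\Gamma\Rightarrow\Delta$. ($\Box$right) $\Box\Gamma_1,\neg\Diamond\Gamma_2\Rightarrow\Diamond\Delta_1,\neg\Box\Delta_2,\alpha$ / $\Box\Gamma_1,\neg\Diamond\Gamma_2\Rightarrow\Diamond\Delta_1,\neg\Box\Delta_2,\Box\alpha$. ($\Diamond$left) $\alpha,\Box\Gamma_1,\neg\Diamond\Gamma_2\Rightarrow\Diamond\Delta_1,\neg\Box\Delta_2$ / $\Diamond\alpha,\Box\Gamma_1,\neg\Diamond\Gamma_2\Rightarrow\Diamond\Delta_1,\neg\Box\Delta_2$. ($\Diamond$right) $\Gamma\Rightarrow\Delta,\alpha$ / $\Gamma\Rightarrow\Delta,\Diamond\alpha$. Twist rules: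 ($\neg\neg$left$^t$) $\alpha,\Gamma\Rightarrow\Delta$ / $\neg\neg\alpha,\Gamma\Rightarrow\Delta$. ($\neg\neg$right$^t$) $\Gamma\Rightarrow\Delta,\alpha$ / $\Gamma\Rightarrow\Delta,\neg\neg\alpha$. ($\neg\wedge$left$^t$) $\Gamma\Rightarrow\Delta,\alpha$; $\Gamma\Rightarrow\Delta,\beta$ / $\neg(\alpha\wedge\beta),\Gamma\Rightarrow\Delta$. ($\neg\wedge$right$^t$) $\alpha,\beta,\Gamma\Rightarrow\Delta$ / $\Gamma\Rightarrow\Delta,\neg(\alpha\wedge\beta)$. ($\neg\vee$left$^t$) $\Gamma\Rightarrow\Delta,\alpha,\beta$ / $\neg(\alpha\vee\beta),\Gamma\Rightarrow\Delta$. ($\neg\vee$right$^t$) $\alpha,\Gamma\Rightarrow\Delta$; $\beta,\Gamma\Rightarrow\Delta$ / $\Gamma\Rightarrow\Delta,\neg(\alpha\vee\beta)$. ($\neg\to$left$^t$) $\alpha,\Gamma\Rightarrow\Delta,\beta$ / $\neg(\alpha\to\beta),\Gamma\Rightarrow\Delta$. ($\neg\to$right$^t$) $\Gamma\Rightarrow\Delta,\alpha$; $\beta,\Gamma\Rightarrow\Delta$ / $\Gamma\Rightarrow\Delta,\neg(\alpha\to\beta)$. ($\neg\Box$left$^t$) $\Box\Gamma_1,\neg\Diamond\Gamma_2\Rightarrow\Diamond\Delta_1,\neg\Box\Delta_2,\alpha$ / $\neg\Box\alpha,\Box\Gamma_1,\neg\Diamond\Gamma_2\Rightarrow\Diamond\Delta_1,\neg\Box\Delta_2$.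 ($\neg\Box$right$^t$) $\alpha,\Gamma\Rightarrow\Delta$ / $\Gamma\Rightarrow\Delta,\neg\Box\alpha$. ($\neg\Diamond$left$^t$) $\Gamma\Rightarrow\Delta,\alpha$ / $\neg\Diamond\alpha,\Gamma\Rightarrow\Delta$. ($\neg\Diamond$right$^t$) $\alpha,\Box\Gamma_1,\neg\Diamond\Gamma_2\Rightarrow\Diamond\Delta_1,\neg\Box\Delta_2$ / $\Box\Gamma_1,\neg\Diamond\Gamma_2\Rightarrow\Diamond\Delta_1,\neg\Box\Delta_2,\neg\Diamond\alpha$. The calculus gTS4 is obtained from lTS4 by replacing ($\Box$right), ($\Diamond$left), ($\neg\Box$left$^t$), ($\neg\Diamond$right$^t$) with: ($\Box$right$^T$) $\Box\Gamma_1,\Box\Delta_2\Rightarrow\Diamond\Delta_1,\Diamond\Gamma_2,\alpha$ / $\Box\Gamma_1,\neg\Diamond\Gamma_2\Rightarrow\Diamond\Delta_1,\neg\Box\Delta_2,\Box\alpha$. ($\Diamond$left$^T$) $\alpha,\Box\Gamma_1,\Box\Delta_2\Rightarrow\Diamond\Delta_1,\Diamond\Gamma_2$ / $\Diamond\alpha,\Box\Gamma_1,\neg\Diamond\Gamma_2\Rightarrow\Diamond\Delta_1,\neg\Box\Delta_2$. ($\neg\Box$left$^T$) $\Box\Gamma_1,\Box\Delta_2\Rightarrow\Diamond\Delta_1,\Diamond\Gamma_2,\alpha$ / $\neg\Box\alpha,\Box\Gamma_1,\neg\Diamond\Gamma_2\Rightarrow\Diamond\Delta_1,\neg\Box\Delta_2$.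 ($\neg\Diamond$right$^T$) $\alpha,\Box\Gamma_1,\Box\Delta_2\Rightarrow\Diamond\Delta_1,\Diamond\Gamma_2$ / $\Box\Gamma_1,\neg\Diamond\Gamma_2\Rightarrow\Diamond\Delta_1,\neg\Box\Delta_2,\neg\Diamond\alpha$. (All other rules and initial sequents of lTS4, including ($\neg\Diamond$left$^t$), are kept.) -}

module Defs where

open import Data.Nat using (ℕ)
open import Data.List using (List; []; _∷_; [_]; _++_; map)
open import Data.List.Membership.Propositional using (_∈_)
open import Data.List.Relation.Unary.All using (All)
open import Data.Product using (Σ; _×_; ∃; ∃-syntax)
open import Data.Unit using (⊤)

infixr 30 ~_ □_ ◇_
infixr 20 _∧_
infixr 19 _∨_
infixr 18 _⇒_

-- Formulas over countably many propositional variables (indexed by ℕ).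
-- ~ is the (twist) negation ¬ of the paper.
data Fm : Set where
  var      : ℕ → Fm
  _∧_ _∨_ _⇒_ : Fm → Fm → Fm
  ~_ □_ ◇_ : Fm → Fm

data _≼_ : Fm → Fm → Set where
  ≼-refl : ∀ {φ} → φ ≼ φ
  ≼-∧ˡ : ∀ {φ α β} → φ ≼ α → φ ≼ (α ∧ β)
  ≼-∧ʳ : ∀ {φ α β} → φ ≼ β → φ ≼ (α ∧ β)
  ≼-∨ˡ : ∀ {φ α β} → φ ≼ α → φ ≼ (α ∨ β)
  ≼-∨ʳ : ∀ {φ α β} → φ ≼ β → φ ≼ (α ∨ β)
  ≼-⇒ˡ : ∀ {φ α β} → φ ≼ α → φ ≼ (α ⇒ β)
  ≼-⇒ʳ : ∀ {φ α β} → φ ≼ β → φ ≼ (α ⇒ β)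
  ≼-~  : ∀ {φ α} → φ ≼ α → φ ≼ (~ α)
  ≼-□  : ∀ {φ α} → φ ≼ α → φ ≼ (□ α)
  ≼-◇  : ∀ {φ α} → φ ≼ α → φ ≼ (◇ α)

-- Finite sets of formulas are represented by lists, considered up to
-- set equality (same members); see the rule `setEq` below.
Ctx : Set
Ctx = List Fm

_⊆_ : Ctx → Ctx → Set
Γ ⊆ Δ = ∀ {φ} → φ ∈ Γ → φ ∈ Δ

_≈ₛ_ : Ctx → Ctx → Set
Γ ≈ₛ Δ = (Γ ⊆ Δ) × (Δ ⊆ Γ)

boxL : Ctx → Ctx → Ctx
boxL Γ₁ Γ₂ = map □_ Γ₁ ++ map (λ x → ~ ◇ x) Γ₂

diaR : Ctx → Ctx → Ctx
diaR Δ₁ Δ₂ = map ◇_ Δ₁ ++ map (λ x → ~ □ x) Δ₂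

data Calc : Set where
  lTS4 gTS4 : Calc

-- Derivations  Der L Γ Δ  of the sequent Γ ⇒ Δ in calculus L.
-- "Γ ⇒ Δ, α" is written with α consed onto Δ; order/multiplicity are
-- irrelevant because of the rule setEq (sequent sides are sets).
data Der : Calc → Ctx → Ctx → Set where
  setEq : ∀ {L Γ Δ Γ' Δ'} → Γ ≈ₛ Γ' → Δ ≈ₛ Δ' → Der L Γ Δ → Der L Γ' Δ'
  ax₁ : ∀ {L} n → Der L [ var n ] [ var n ]
  ax₂ : ∀ {L} n → Der L [ ~ var n ] [ ~ var n ]
  ax₃ : ∀ {L} n → Der L (~ var n ∷ var n ∷ []) []
  ax₄ : ∀ {L} n → Der L [] (~ var n ∷ var n ∷ [])
  cut : ∀ {L Γ Δ α} → Der L Γ [ α ] → Der L (α ∷ Γ) Δ → Der L Γ Δ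
  weL : ∀ {L Γ Δ α} → Der L Γ Δ → Der L (α ∷ Γ) Δ
  weR : ∀ {L Γ Δ α} → Der L Γ Δ → Der L Γ (α ∷ Δ)
  ∧L : ∀ {L Γ Δ α β} → Der L (α ∷ β ∷ Γ) Δ → Der L (α ∧ β ∷ Γ) Δ
  ∧R : ∀ {L Γ Δ α β} → Der L Γ (α ∷ Δ) → Der L Γ (β ∷ Δ) → Der L Γ (α ∧ β ∷ Δ)
  ∨L : ∀ {L Γ Δ α β} → Der L (α ∷ Γ) Δ → Der L (β ∷ Γ) Δ → Der L (α ∨ β ∷ Γ) Δ
  ∨R : ∀ {L Γ Δ α β} → Der L Γ (α ∷ β ∷ Δ) → Der L Γ (α ∨ β ∷ Δ)
  ⇒L : ∀ {L Γ Δ α β} → Der L Γ (α ∷ Δ) → Der L (β ∷ Γ) Δ → Der L (α ⇒ β ∷ Γ) Δ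
  ⇒R : ∀ {L Γ Δ α β} → Der L (α ∷ Γ) (β ∷ Δ) → Der L Γ (α ⇒ β ∷ Δ)
  □L : ∀ {L Γ Δ α} → Der L (α ∷ Γ) Δ → Der L (□ α ∷ Γ) Δ
  ◇R : ∀ {L Γ Δ α} → Der L Γ (α ∷ Δ) → Der L Γ (◇ α ∷ Δ)
  ~~L : ∀ {L Γ Δ α} → Der L (α ∷ Γ) Δ → Der L (~ ~ α ∷ Γ) Δ
  ~~R : ∀ {L Γ Δ α} → Der L Γ (α ∷ Δ) → Der L Γ (~ ~ α ∷ Δ)
  ~∧L : ∀ {L Γ Δ α β} → Der L Γ (α ∷ Δ) → Der L Γ (β ∷ Δ) → Der L (~ (α ∧ β) ∷ Γ) Δ
  ~∧R : ∀ {L Γ Δ α β} → Der L (α ∷ β ∷ Γ) Δ → Der L Γ (~ (α ∧ β) ∷ Δ)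
  ~∨L : ∀ {L Γ Δ α β} → Der L Γ (α ∷ β ∷ Δ) → Der L (~ (α ∨ β) ∷ Γ) Δ
  ~∨R : ∀ {L Γ Δ α β} → Der L (α ∷ Γ) Δ → Der L (β ∷ Γ) Δ → Der L Γ (~ (α ∨ β) ∷ Δ)
  ~⇒L : ∀ {L Γ Δ α β} → Der L (α ∷ Γ) (β ∷ Δ) → Der L (~ (α ⇒ β) ∷ Γ) Δ
  ~⇒R : ∀ {L Γ Δ α β} → Der L Γ (α ∷ Δ) → Der L (β ∷ Γ) Δ → Der L Γ (~ (α ⇒ β) ∷ Δ)
  ~□R : ∀ {L Γ Δ α} → Der L (α ∷ Γ) Δ → Der L Γ (~ □ α ∷ Δ)
  ~◇L : ∀ {L Γ Δ α} → Der L Γ (α ∷ Δ) → Der L (~ ◇ α ∷ Γ) Δ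
  □Rˡ : ∀ {Γ₁ Γ₂ Δ₁ Δ₂ α} → Der lTS4 (boxL Γ₁ Γ₂) (α ∷ diaR Δ₁ Δ₂)
      → Der lTS4 (boxL Γ₁ Γ₂) (□ α ∷ diaR Δ₁ Δ₂)
  ◇Lˡ : ∀ {Γ₁ Γ₂ Δ₁ Δ₂ α} → Der lTS4 (α ∷ boxL Γ₁ Γ₂) (diaR Δ₁ Δ₂)
      → Der lTS4 (◇ α ∷ boxL Γ₁ Γ₂) (diaR Δ₁ Δ₂)
  ~□Lˡ : ∀ {Γ₁ Γ₂ Δ₁ Δ₂ α} → Der lTS4 (boxL Γ₁ Γ₂) (α ∷ diaR Δ₁ Δ₂)
      → Der lTS4 (~ □ α ∷ boxL Γ₁ Γ₂) (diaR Δ₁ Δ₂)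
  ~◇Rˡ : ∀ {Γ₁ Γ₂ Δ₁ Δ₂ α} → Der lTS4 (α ∷ boxL Γ₁ Γ₂) (diaR Δ₁ Δ₂)
      → Der lTS4 (boxL Γ₁ Γ₂) (~ ◇ α ∷ diaR Δ₁ Δ₂)
  □Rᵍ : ∀ {Γ₁ Γ₂ Δ₁ Δ₂ α}
      → Der gTS4 (map □_ Γ₁ ++ map □_ Δ₂) (α ∷ map ◇_ Δ₁ ++ map ◇_ Γ₂)
      → Der gTS4 (boxL Γ₁ Γ₂) (□ α ∷ diaR Δ₁ Δ₂)
  ◇Lᵍ : ∀ {Γ₁ Γ₂ Δ₁ Δ₂ α}
      → Der gTS4 (α ∷ map □_ Γ₁ ++ map □_ Δ₂) (map ◇_ Δ₁ ++ map ◇_ Γ₂)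
      → Der gTS4 (◇ α ∷ boxL Γ₁ Γ₂) (diaR Δ₁ Δ₂)
  ~□Lᵍ : ∀ {Γ₁ Γ₂ Δ₁ Δ₂ α}
      → Der gTS4 (map □_ Γ₁ ++ map □_ Δ₂) (α ∷ map ◇_ Δ₁ ++ map ◇_ Γ₂)
      → Der gTS4 (~ □ α ∷ boxL Γ₁ Γ₂) (diaR Δ₁ Δ₂)
  ~◇Rᵍ : ∀ {Γ₁ Γ₂ Δ₁ Δ₂ α}
      → Der gTS4 (α ∷ map □_ Γ₁ ++ map □_ Δ₂) (map ◇_ Δ₁ ++ map ◇_ Γ₂)
      → Der gTS4 (boxL Γ₁ Γ₂) (~ ◇ α ∷ diaR Δ₁ Δ₂)

EverySeq : ∀ {L Γ Δ} (Q : Ctx → Ctx → Set) → Der L Γ Δ → Set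
Premises : ∀ {L Γ Δ} (Q : Ctx → Ctx → Set) → Der L Γ Δ → Set

EverySeq {Γ = Γ} {Δ} Q P = Q Γ Δ × Premises Q P

Premises Q (setEq _ _ p) = EverySeq Q p
Premises Q (ax₁ _) = ⊤
Premises Q (ax₂ _) = ⊤
Premises Q (ax₃ _) = ⊤
Premises Q (ax₄ _) = ⊤
Premises Q (cut p q) = EverySeq Q p × EverySeq Q q
Premises Q (weL p) = EverySeq Q p
Premises Q (weR p) = EverySeq Q p
Premises Q (∧L p) = EverySeq Q p
Premises Q (∧R p q) = EverySeq Q p × EverySeq Q q
Premises Q (∨L p q) = EverySeq Q p × EverySeq Q q
Premises Q (∨R p) = EverySeq Q p
Premises Q (⇒L p q) = EverySeq Q p × EverySeq Q q
Premises Q (⇒R p) = EverySeq Q p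
Premises Q (□L p) = EverySeq Q p
Premises Q (◇R p) = EverySeq Q p
Premises Q (~~L p) = EverySeq Q p
Premises Q (~~R p) = EverySeq Q p
Premises Q (~∧L p q) = EverySeq Q p × EverySeq Q q
Premises Q (~∧R p) = EverySeq Q p
Premises Q (~∨L p) = EverySeq Q p
Premises Q (~∨R p q) = EverySeq Q p × EverySeq Q q
Premises Q (~⇒L p) = EverySeq Q p
Premises Q (~⇒R p q) = EverySeq Q p × EverySeq Q q
Premises Q (~□R p) = EverySeq Q p
Premises Q (~◇L p) = EverySeq Q p
Premises Q (□Rˡ p) = EverySeq Q p
Premises Q (◇Lˡ p) = EverySeq Q p
Premises Q (~□Lˡ p) = EverySeq Q p
Premises Q (~◇Rˡ p) = EverySeq Q p
Premises Q (□Rᵍ p) = EverySeq Q p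
Premises Q (◇Lᵍ p) = EverySeq Q p
Premises Q (~□Lᵍ p) = EverySeq Q p
Premises Q (~◇Rᵍ p) = EverySeq Q p

SubOf : Ctx → Ctx → Fm → Set
SubOf Γ Δ φ = ∃[ ψ ] (ψ ∈ Γ ++ Δ × φ ≼ ψ)

HasSubformulaProp : ∀ {L Γ Δ} → Der L Γ Δ → Set
HasSubformulaProp {Γ = Γ} {Δ} P =
  EverySeq (λ Γ' Δ' → All (SubOf Γ Δ) (Γ' ++ Δ')) P

module Submission where

open import Defs
open import Data.Nat using (ℕ)
open import Data.Maybe using (Maybe; just; nothing)
open import Data.List using (List; []; _∷_; _++_; map)
open import Data.List.Membership.Propositional using (_∈_)
open import Data.List.Membership.Propositional.Properties using (∈-++⁺ˡ; ∈-++⁺ʳ; ∈-++⁻; ∈-map⁺; ∈-map⁻)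
open import Data.List.Relation.Unary.Any using (here; there)
open import Data.List.Relation.Unary.All using (All; []; _∷_; tabulate; lookup)
open import Data.List.Relation.Binary.Subset.Propositional.Properties
  using (⊆-refl; ⊆-trans; xs⊆x∷xs; ∷⁺ʳ; ++⁺ʳ; xs⊆ys++xs; ⊆-reflexive-↭)
open import Data.List.Relation.Binary.Permutation.Propositional.Properties using (shift)
open import Data.Product using (Σ; _×_; _,_; ∃-syntax; proj₁; proj₂)
open import Data.Sum using (_⊎_; inj₁; inj₂; [_,_]) renaming (map to ⊎-map)
open import Data.Unit using (tt)
open import Function using (_∘′_)
open import Data.Empty using (⊥-elim)
open import Relation.Binary.PropositionalEquality using (_≡_; refl; sym; trans)
open import Relation.Nullary using (¬_; Dec; yes; no)

-- The proof is by cut elimination in an auxiliary calculus without cut, in which sequents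
-- are pairs of sets and a rule only requires its principal formula to occur in the
-- conclusion, so that weakening and contraction are built in. For lTS4, cut is admissible
-- there by induction on the cut formula and then on the two derivations; the only
-- non-standard case is a cut on ◇a or ¬□a kept as a side formula by the modal rule ending
-- the left premise: it is pushed into the right premise until ◇L or ¬□L introduces it,
-- and then cut inside the premise of the first modal rule. Since □a on the left and ¬□a
-- on the right (likewise ¬◇a and ◇a) have rules with the same premises, the modal rules
-- of gTS4 are admissible in the calculus for lTS4, and conversely its lTS4-derivations
-- become gTS4-derivations. Every premise of a rule of the auxiliary calculus consists of
-- subformulas of the conclusion, so translating a derivation back yields a proof in which
-- every formula is a subformula of the end sequent.

variable
  L : Calc
  Γ Γ' Γ₁ Γ₂ Γₚ Δ Δ' Δ₁ Δ₂ Δₚ : Ctx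
  a b x α φ : Fm
  n : ℕ

≼-trans : x ≼ a → a ≼ b → x ≼ b
≼-trans p ≼-refl   = p
≼-trans p (≼-∧ˡ q) = ≼-∧ˡ (≼-trans p q)
≼-trans p (≼-∧ʳ q) = ≼-∧ʳ (≼-trans p q)
≼-trans p (≼-∨ˡ q) = ≼-∨ˡ (≼-trans p q)
≼-trans p (≼-∨ʳ q) = ≼-∨ʳ (≼-trans p q)
≼-trans p (≼-⇒ˡ q) = ≼-⇒ˡ (≼-trans p q)
≼-trans p (≼-⇒ʳ q) = ≼-⇒ʳ (≼-trans p q)
≼-trans p (≼-~ q)  = ≼-~ (≼-trans p q)
≼-trans p (≼-□ q)  = ≼-□ (≼-trans p q)
≼-trans p (≼-◇ q)  = ≼-◇ (≼-trans p q)

⊆-++ : ∀ X → Γ' ⊆ Γ → Γ' ⊆ (X ++ Γ)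
⊆-++ {Γ = Γ} X f = ⊆-trans f (xs⊆ys++xs Γ X)

⊆-∷-++ : ∀ X → Γ' ⊆ (α ∷ Γ) → Γ' ⊆ (α ∷ X ++ Γ)
⊆-∷-++ {α = α} {Γ = Γ} X f = ⊆-trans f (∷⁺ʳ α (xs⊆ys++xs Γ X))

++⁺ʳ-∷ : ∀ X → Γ' ⊆ (α ∷ Γ) → (X ++ Γ') ⊆ (α ∷ X ++ Γ)
++⁺ʳ-∷ {α = α} {Γ = Γ} X f = ⊆-trans (++⁺ʳ X f) (⊆-reflexive-↭ (shift α X Γ))

++-⊆ : ∀ A → A ⊆ Γ → Γ' ⊆ Γ → (A ++ Γ') ⊆ Γ
++-⊆ A f g p = [ f , g ] (∈-++⁻ A p)

∈-∷-drop : ∀ (P : Fm → Set) → ¬ P x → P α → Γ' ⊆ (α ∷ Γ) → x ∈ Γ' → x ∈ Γ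
∈-∷-drop P ¬px pα f p with f p
... | here refl = ⊥-elim (¬px pα)
... | there q   = q

∈-map-++-map⁻ : ∀ (f g : Fm → Fm) A {B} → x ∈ map f A ++ map g B →
                (∃[ a ] a ∈ A × x ≡ f a) ⊎ (∃[ a ] a ∈ B × x ≡ g a)
∈-map-++-map⁻ f g A p = ⊎-map (∈-map⁻ f) (∈-map⁻ g) (∈-++⁻ (map f A) p)

-- Modal side formulas

record Pattern : Set where
  field
    wrap       : Fm → Fm
    match      : ∀ x → Maybe (∃[ a ] wrap a ≡ x)
    match-wrap : ∀ a → match (wrap a) ≡ just (a , refl)
open Pattern

arguments : Pattern → Ctx → Ctx
arguments π [] = []
arguments π (x ∷ Γ) with match π x
... | just (a , _) = a ∷ arguments π Γ
... | nothing      = arguments π Γ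

∈-arguments⁺ : ∀ π → wrap π a ∈ Γ → a ∈ arguments π Γ
∈-arguments⁺ {a = a} π (here refl) rewrite match-wrap π a = here refl
∈-arguments⁺ {Γ = x ∷ _} π (there p) with match π x
... | just _  = there (∈-arguments⁺ π p)
... | nothing = ∈-arguments⁺ π p

∈-arguments⁻ : ∀ π → a ∈ arguments π Γ → wrap π a ∈ Γ
∈-arguments⁻ {Γ = x ∷ _} π p with match π x
∈-arguments⁻ π (here refl) | just (_ , refl) = here refl
∈-arguments⁻ π (there p)   | just _          = there (∈-arguments⁻ π p)
∈-arguments⁻ π p           | nothing         = there (∈-arguments⁻ π p)

matches? : ∀ π x → Dec (∃[ a ] wrap π a ≡ x)
matches? π x with match π x in eq
... | just m  = yes m
... | nothing = no λ { (a , refl) → just≢nothing (trans (sym (match-wrap π a)) eq) }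
  where
  just≢nothing : ∀ {A : Set} {m : A} → ¬ just m ≡ nothing
  just≢nothing ()

□ᵖ ◇ᵖ ~□ᵖ ~◇ᵖ : Pattern
□ᵖ = record { wrap = □_ ; match = λ { (□ a) → just (a , refl) ; _ → nothing }
             ; match-wrap = λ _ → refl }
◇ᵖ = record { wrap = ◇_ ; match = λ { (◇ a) → just (a , refl) ; _ → nothing }
             ; match-wrap = λ _ → refl }
~□ᵖ = record { wrap = λ a → ~ □ a ; match = λ { (~ □ a) → just (a , refl) ; _ → nothing }
              ; match-wrap = λ _ → refl }
~◇ᵖ = record { wrap = λ a → ~ ◇ a ; match = λ { (~ ◇ a) → just (a , refl) ; _ → nothing }
              ; match-wrap = λ _ → refl }

data Necessity : Fm → Set where
  nec□  : ∀ a → Necessity (□ a)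
  nec~◇ : ∀ a → Necessity (~ ◇ a)

data Possibility : Fm → Set where
  pos◇  : ∀ a → Possibility (◇ a)
  pos~□ : ∀ a → Possibility (~ □ a)

necessity? : ∀ x → Dec (Necessity x)
necessity? x with matches? □ᵖ x | matches? ~◇ᵖ x
... | yes (a , refl) | _              = yes (nec□ a)
... | no _           | yes (a , refl) = yes (nec~◇ a)
... | no ¬□          | no ¬~◇         = no λ { (nec□ a) → ¬□ (a , refl) ; (nec~◇ a) → ¬~◇ (a , refl) }

possibility? : ∀ x → Dec (Possibility x)
possibility? x with matches? ◇ᵖ x | matches? ~□ᵖ x
... | yes (a , refl) | _              = yes (pos◇ a)
... | no _           | yes (a , refl) = yes (pos~□ a)
... | no ¬◇          | no ¬~□         = no λ { (pos◇ a) → ¬◇ (a , refl) ; (pos~□ a) → ¬~□ (a , refl) }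

possibility⇒¬necessity : Possibility α → ¬ Necessity α
possibility⇒¬necessity (pos◇ _)  ()
possibility⇒¬necessity (pos~□ _) ()

-- The side formulas kept by the modal rules of lTS4:
-- □Γ₁, ¬◇Γ₂ on the left and ◇Δ₁, ¬□Δ₂ on the right.
necessities : Ctx → Ctx
necessities Γ = boxL (arguments □ᵖ Γ) (arguments ~◇ᵖ Γ)

possibilities : Ctx → Ctx
possibilities Δ = diaR (arguments ◇ᵖ Δ) (arguments ~□ᵖ Δ)

∈-necessities⁻ : x ∈ necessities Γ → x ∈ Γ × Necessity x
∈-necessities⁻ {Γ = Γ} p with ∈-map-++-map⁻ □_ _ (arguments □ᵖ Γ) p
... | inj₁ (a , q , refl) = ∈-arguments⁻ □ᵖ q , nec□ a
... | inj₂ (a , q , refl) = ∈-arguments⁻ ~◇ᵖ q , nec~◇ a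

∈-necessities⁺ : x ∈ Γ → Necessity x → x ∈ necessities Γ
∈-necessities⁺ p (nec□ a) = ∈-++⁺ˡ (∈-map⁺ □_ (∈-arguments⁺ □ᵖ p))
∈-necessities⁺ {Γ = Γ} p (nec~◇ a) = ∈-++⁺ʳ (map □_ (arguments □ᵖ Γ)) (∈-map⁺ _ (∈-arguments⁺ ~◇ᵖ p))

∈-possibilities⁻ : x ∈ possibilities Δ → x ∈ Δ × Possibility x
∈-possibilities⁻ {Δ = Δ} p with ∈-map-++-map⁻ ◇_ _ (arguments ◇ᵖ Δ) p
... | inj₁ (a , q , refl) = ∈-arguments⁻ ◇ᵖ q , pos◇ a
... | inj₂ (a , q , refl) = ∈-arguments⁻ ~□ᵖ q , pos~□ a

∈-possibilities⁺ : x ∈ Δ → Possibility x → x ∈ possibilities Δ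
∈-possibilities⁺ p (pos◇ a) = ∈-++⁺ˡ (∈-map⁺ ◇_ (∈-arguments⁺ ◇ᵖ p))
∈-possibilities⁺ {Δ = Δ} p (pos~□ a) = ∈-++⁺ʳ (map ◇_ (arguments ◇ᵖ Δ)) (∈-map⁺ _ (∈-arguments⁺ ~□ᵖ p))

module Selection {P : Fm → Set} {select : Ctx → Ctx}
  (select⁻ : ∀ {x Γ} → x ∈ select Γ → x ∈ Γ × P x)
  (select⁺ : ∀ {x Γ} → x ∈ Γ → P x → x ∈ select Γ) where

  ⊆-self : select Γ ⊆ Γ
  ⊆-self p = proj₁ (select⁻ p)

  mono : Γ ⊆ Γ' → select Γ ⊆ select Γ'
  mono f p = let q , px = select⁻ p in select⁺ (f q) px

  ⊆-select-++ : ∀ X Γ → select Γ ⊆ select (X ++ select Γ)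
  ⊆-select-++ X Γ p = select⁺ (∈-++⁺ʳ X p) (proj₂ (select⁻ p))

  keep : Γ' ⊆ (α ∷ Γ) → select Γ' ⊆ (α ∷ select Γ)
  keep f p with select⁻ p
  ... | q , px with f q
  ...   | here refl = here refl
  ...   | there r   = there (select⁺ r px)

  drop : ¬ P α → Γ' ⊆ (α ∷ Γ) → select Γ' ⊆ select Γ
  drop ¬pα f p with select⁻ p
  ... | q , px with f q
  ...   | here refl = ⊥-elim (¬pα px)
  ...   | there r   = select⁺ r px

module Nec = Selection ∈-necessities⁻ ∈-necessities⁺
module Pos = Selection ∈-possibilities⁻ ∈-possibilities⁺

-- The premises of the modal rules of gTS4: □Γ₁, □Δ₂ on the left and ◇Δ₁, ◇Γ₂ on the right.
necessitiesᵍ : Ctx → Ctx → Ctx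
necessitiesᵍ Γ Δ = map □_ (arguments □ᵖ Γ) ++ map □_ (arguments ~□ᵖ Δ)

possibilitiesᵍ : Ctx → Ctx → Ctx
possibilitiesᵍ Γ Δ = map ◇_ (arguments ◇ᵖ Δ) ++ map ◇_ (arguments ~◇ᵖ Γ)

∈-necessitiesᵍ⁻ : ∀ Γ Δ → x ∈ necessitiesᵍ Γ Δ → ∃[ a ] x ≡ □ a × (□ a ∈ Γ ⊎ ~ □ a ∈ Δ)
∈-necessitiesᵍ⁻ Γ Δ p with ∈-map-++-map⁻ □_ □_ (arguments □ᵖ Γ) p
... | inj₁ (a , q , refl) = a , refl , inj₁ (∈-arguments⁻ □ᵖ q)
... | inj₂ (a , q , refl) = a , refl , inj₂ (∈-arguments⁻ ~□ᵖ q)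

∈-necessitiesᵍ⁺ : ∀ Γ Δ → □ a ∈ Γ ⊎ ~ □ a ∈ Δ → □ a ∈ necessitiesᵍ Γ Δ
∈-necessitiesᵍ⁺ Γ Δ (inj₁ p) = ∈-++⁺ˡ (∈-map⁺ □_ (∈-arguments⁺ □ᵖ p))
∈-necessitiesᵍ⁺ Γ Δ (inj₂ p) = ∈-++⁺ʳ (map □_ (arguments □ᵖ Γ)) (∈-map⁺ □_ (∈-arguments⁺ ~□ᵖ p))

∈-possibilitiesᵍ⁻ : ∀ Γ Δ → x ∈ possibilitiesᵍ Γ Δ → ∃[ a ] x ≡ ◇ a × (◇ a ∈ Δ ⊎ ~ ◇ a ∈ Γ)
∈-possibilitiesᵍ⁻ Γ Δ p with ∈-map-++-map⁻ ◇_ ◇_ (arguments ◇ᵖ Δ) p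
... | inj₁ (a , q , refl) = a , refl , inj₁ (∈-arguments⁻ ◇ᵖ q)
... | inj₂ (a , q , refl) = a , refl , inj₂ (∈-arguments⁻ ~◇ᵖ q)

∈-possibilitiesᵍ⁺ : ∀ Γ Δ → ◇ a ∈ Δ ⊎ ~ ◇ a ∈ Γ → ◇ a ∈ possibilitiesᵍ Γ Δ
∈-possibilitiesᵍ⁺ Γ Δ (inj₁ p) = ∈-++⁺ˡ (∈-map⁺ ◇_ (∈-arguments⁺ ◇ᵖ p))
∈-possibilitiesᵍ⁺ Γ Δ (inj₂ p) = ∈-++⁺ʳ (map ◇_ (arguments ◇ᵖ Δ)) (∈-map⁺ ◇_ (∈-arguments⁺ ~◇ᵖ p))

modalPremiseˡ modalPremiseʳ : Calc → Ctx → Ctx → Ctx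
modalPremiseˡ lTS4 Γ Δ = necessities Γ
modalPremiseˡ gTS4 Γ Δ = necessitiesᵍ Γ Δ
modalPremiseʳ lTS4 Γ Δ = possibilities Δ
modalPremiseʳ gTS4 Γ Δ = possibilitiesᵍ Γ Δ

-- A cut-free calculus on sets of formulas

data Side : Set where
  left right : Side

Occurs : Side → Ctx → Ctx → Fm → Set
Occurs left  Γ Δ φ = φ ∈ Γ
Occurs right Γ Δ φ = φ ∈ Δ

-- A premise (Γ' , Δ') of a rule stands for the sequent Γ', Γ ⇒ Δ', Δ.
data Rule : Fm → Side → List (Ctx × Ctx) → Set where
  ∧L  : Rule (a ∧ b) left  ((a ∷ b ∷ [] , []) ∷ [])
  ∧R  : Rule (a ∧ b) right (([] , a ∷ []) ∷ ([] , b ∷ []) ∷ [])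
  ∨L  : Rule (a ∨ b) left  ((a ∷ [] , []) ∷ (b ∷ [] , []) ∷ [])
  ∨R  : Rule (a ∨ b) right (([] , a ∷ b ∷ []) ∷ [])
  ⇒L  : Rule (a ⇒ b) left  (([] , a ∷ []) ∷ (b ∷ [] , []) ∷ [])
  ⇒R  : Rule (a ⇒ b) right ((a ∷ [] , b ∷ []) ∷ [])
  □L  : Rule (□ a) left  ((a ∷ [] , []) ∷ [])
  ◇R  : Rule (◇ a) right (([] , a ∷ []) ∷ [])
  ~~L : Rule (~ ~ a) left  ((a ∷ [] , []) ∷ [])
  ~~R : Rule (~ ~ a) right (([] , a ∷ []) ∷ [])
  ~∧L : Rule (~ (a ∧ b)) left  (([] , a ∷ []) ∷ ([] , b ∷ []) ∷ [])
  ~∧R : Rule (~ (a ∧ b)) right ((a ∷ b ∷ [] , []) ∷ [])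
  ~∨L : Rule (~ (a ∨ b)) left  (([] , a ∷ b ∷ []) ∷ [])
  ~∨R : Rule (~ (a ∨ b)) right ((a ∷ [] , []) ∷ (b ∷ [] , []) ∷ [])
  ~⇒L : Rule (~ (a ⇒ b)) left  ((a ∷ [] , b ∷ []) ∷ [])
  ~⇒R : Rule (~ (a ⇒ b)) right (([] , a ∷ []) ∷ (b ∷ [] , []) ∷ [])
  ~□R : Rule (~ □ a) right ((a ∷ [] , []) ∷ [])
  ~◇L : Rule (~ ◇ a) left  (([] , a ∷ []) ∷ [])

rule-subformulas : ∀ {s ps} → Rule φ s ps → All (λ e → All (_≼ φ) (proj₁ e ++ proj₂ e)) ps
rule-subformulas ∧L  = (≼-∧ˡ ≼-refl ∷ ≼-∧ʳ ≼-refl ∷ []) ∷ []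
rule-subformulas ∧R  = (≼-∧ˡ ≼-refl ∷ []) ∷ (≼-∧ʳ ≼-refl ∷ []) ∷ []
rule-subformulas ∨L  = (≼-∨ˡ ≼-refl ∷ []) ∷ (≼-∨ʳ ≼-refl ∷ []) ∷ []
rule-subformulas ∨R  = (≼-∨ˡ ≼-refl ∷ ≼-∨ʳ ≼-refl ∷ []) ∷ []
rule-subformulas ⇒L  = (≼-⇒ˡ ≼-refl ∷ []) ∷ (≼-⇒ʳ ≼-refl ∷ []) ∷ []
rule-subformulas ⇒R  = (≼-⇒ˡ ≼-refl ∷ ≼-⇒ʳ ≼-refl ∷ []) ∷ []
rule-subformulas □L  = (≼-□ ≼-refl ∷ []) ∷ []
rule-subformulas ◇R  = (≼-◇ ≼-refl ∷ []) ∷ []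
rule-subformulas ~~L = (≼-~ (≼-~ ≼-refl) ∷ []) ∷ []
rule-subformulas ~~R = (≼-~ (≼-~ ≼-refl) ∷ []) ∷ []
rule-subformulas ~∧L = (≼-~ (≼-∧ˡ ≼-refl) ∷ []) ∷ (≼-~ (≼-∧ʳ ≼-refl) ∷ []) ∷ []
rule-subformulas ~∧R = (≼-~ (≼-∧ˡ ≼-refl) ∷ ≼-~ (≼-∧ʳ ≼-refl) ∷ []) ∷ []
rule-subformulas ~∨L = (≼-~ (≼-∨ˡ ≼-refl) ∷ ≼-~ (≼-∨ʳ ≼-refl) ∷ []) ∷ []
rule-subformulas ~∨R = (≼-~ (≼-∨ˡ ≼-refl) ∷ []) ∷ (≼-~ (≼-∨ʳ ≼-refl) ∷ []) ∷ []
rule-subformulas ~⇒L = (≼-~ (≼-⇒ˡ ≼-refl) ∷ ≼-~ (≼-⇒ʳ ≼-refl) ∷ []) ∷ []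
rule-subformulas ~⇒R = (≼-~ (≼-⇒ˡ ≼-refl) ∷ []) ∷ (≼-~ (≼-⇒ʳ ≼-refl) ∷ []) ∷ []
rule-subformulas ~□R = (≼-~ (≼-□ ≼-refl) ∷ []) ∷ []
rule-subformulas ~◇L = (≼-~ (≼-◇ ≼-refl) ∷ []) ∷ []

data ModalRule : Set where
  □R ◇L ~□L ~◇R : Fm → ModalRule

Principal : ModalRule → Ctx → Ctx → Set
Principal (□R a)  Γ Δ = □ a ∈ Δ
Principal (◇L a)  Γ Δ = ◇ a ∈ Γ
Principal (~□L a) Γ Δ = ~ □ a ∈ Γ
Principal (~◇R a) Γ Δ = ~ ◇ a ∈ Δ

activeˡ activeʳ : ModalRule → Ctx
activeˡ (□R a)  = []
activeˡ (◇L a)  = a ∷ []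
activeˡ (~□L a) = []
activeˡ (~◇R a) = a ∷ []
activeʳ (□R a)  = a ∷ []
activeʳ (◇L a)  = []
activeʳ (~□L a) = a ∷ []
activeʳ (~◇R a) = []

principal-++ : ∀ k X Y → Principal k Γ Δ → Principal k (X ++ Γ) (Y ++ Δ)
principal-++ (□R a)  X Y p = ∈-++⁺ʳ Y p
principal-++ (◇L a)  X Y p = ∈-++⁺ʳ X p
principal-++ (~□L a) X Y p = ∈-++⁺ʳ X p
principal-++ (~◇R a) X Y p = ∈-++⁺ʳ Y p

principalˡ principalʳ : ModalRule → Ctx
principalˡ (□R a)  = []
principalˡ (◇L a)  = ◇ a ∷ []
principalˡ (~□L a) = ~ □ a ∷ []
principalˡ (~◇R a) = []
principalʳ (□R a)  = □ a ∷ []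
principalʳ (◇L a)  = []
principalʳ (~□L a) = []
principalʳ (~◇R a) = ~ ◇ a ∷ []

principal-⊆ : ∀ k → Principal k Γ Δ → principalˡ k ⊆ Γ × principalʳ k ⊆ Δ
principal-⊆ (□R a)  p = (λ ()) , λ { (here refl) → p }
principal-⊆ (◇L a)  p = (λ { (here refl) → p }) , λ ()
principal-⊆ (~□L a) p = (λ { (here refl) → p }) , λ ()
principal-⊆ (~◇R a) p = (λ ()) , λ { (here refl) → p }

-- Principal formulas need only be members of the conclusion, which builds in
-- weakening and contraction.
data CutFree (L : Calc) : Ctx → Ctx → Set where
  ax₁   : var n ∈ Γ → var n ∈ Δ → CutFree L Γ Δ
  ax₂   : ~ var n ∈ Γ → ~ var n ∈ Δ → CutFree L Γ Δ
  ax₃   : ~ var n ∈ Γ → var n ∈ Γ → CutFree L Γ Δ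
  ax₄   : ~ var n ∈ Δ → var n ∈ Δ → CutFree L Γ Δ
  rule  : ∀ {s ps} → Rule φ s ps → Occurs s Γ Δ φ
        → (∀ {e} → e ∈ ps → CutFree L (proj₁ e ++ Γ) (proj₂ e ++ Δ)) → CutFree L Γ Δ
  modal : ∀ k → Principal k Γ Δ
        → CutFree L (activeˡ k ++ modalPremiseˡ L Γ Δ) (activeʳ k ++ modalPremiseʳ L Γ Δ) → CutFree L Γ Δ

-- □a on the left and ¬□a on the right (likewise ¬◇a and ◇a) have rules with the same
-- premises, so either may stand for the other.
data RightTwin : Fm → Ctx → Set where
  □-~□ : ~ □ a ∈ Δ → RightTwin (□ a) Δ
  ~◇-◇ : ◇ a ∈ Δ → RightTwin (~ ◇ a) Δ

data LeftTwin : Fm → Ctx → Set where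
  ~□-□ : □ a ∈ Γ → LeftTwin (~ □ a) Γ
  ◇-~◇ : ~ ◇ a ∈ Γ → LeftTwin (◇ a) Γ

RightTwin-mono : Δ ⊆ Δ' → RightTwin x Δ → RightTwin x Δ'
RightTwin-mono f (□-~□ p) = □-~□ (f p)
RightTwin-mono f (~◇-◇ p) = ~◇-◇ (f p)

LeftTwin-mono : Γ ⊆ Γ' → LeftTwin x Γ → LeftTwin x Γ'
LeftTwin-mono f (~□-□ p) = ~□-□ (f p)
LeftTwin-mono f (◇-~◇ p) = ◇-~◇ (f p)

EmbedsL : Ctx → Ctx → Ctx → Set
EmbedsL Γ Γ' Δ' = ∀ {x} → x ∈ Γ → x ∈ Γ' ⊎ RightTwin x Δ'

EmbedsR : Ctx → Ctx → Ctx → Set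
EmbedsR Δ Δ' Γ' = ∀ {x} → x ∈ Δ → x ∈ Δ' ⊎ LeftTwin x Γ'

EmbedsL-++ : ∀ X Y → EmbedsL Γ Γ' Δ' → EmbedsL (X ++ Γ) (X ++ Γ') (Y ++ Δ')
EmbedsL-++ X Y h p with ∈-++⁻ X p
... | inj₁ q = inj₁ (∈-++⁺ˡ q)
... | inj₂ q = ⊎-map (∈-++⁺ʳ X) (RightTwin-mono (∈-++⁺ʳ Y)) (h q)

EmbedsR-++ : ∀ X Y → EmbedsR Δ Δ' Γ' → EmbedsR (Y ++ Δ) (Y ++ Δ') (X ++ Γ')
EmbedsR-++ X Y h p with ∈-++⁻ Y p
... | inj₁ q = inj₁ (∈-++⁺ˡ q)
... | inj₂ q = ⊎-map (∈-++⁺ʳ Y) (LeftTwin-mono (∈-++⁺ʳ X)) (h q)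

modalPremiseˡ-embeds : ∀ L → EmbedsL Γ Γ' Δ' → EmbedsR Δ Δ' Γ'
  → EmbedsL (modalPremiseˡ L Γ Δ) (modalPremiseˡ L Γ' Δ') (modalPremiseʳ L Γ' Δ')
modalPremiseˡ-embeds lTS4 hl hr p with ∈-necessities⁻ p
... | q , nx with hl q
...   | inj₁ r        = inj₁ (∈-necessities⁺ r nx)
...   | inj₂ (□-~□ r) = inj₂ (□-~□ (∈-possibilities⁺ r (pos~□ _)))
...   | inj₂ (~◇-◇ r) = inj₂ (~◇-◇ (∈-possibilities⁺ r (pos◇ _)))
modalPremiseˡ-embeds {Γ = Γ} {Γ' = Γ'} {Δ' = Δ'} {Δ = Δ} gTS4 hl hr p with ∈-necessitiesᵍ⁻ Γ Δ p
... | a , refl , inj₁ q = inj₁ (∈-necessitiesᵍ⁺ Γ' Δ' ([ inj₁ , (λ { (□-~□ r) → inj₂ r }) ] (hl q)))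
... | a , refl , inj₂ q = inj₁ (∈-necessitiesᵍ⁺ Γ' Δ' ([ inj₂ , (λ { (~□-□ r) → inj₁ r }) ] (hr q)))

modalPremiseʳ-embeds : ∀ L → EmbedsL Γ Γ' Δ' → EmbedsR Δ Δ' Γ'
  → EmbedsR (modalPremiseʳ L Γ Δ) (modalPremiseʳ L Γ' Δ') (modalPremiseˡ L Γ' Δ')
modalPremiseʳ-embeds lTS4 hl hr p with ∈-possibilities⁻ p
... | q , px with hr q
...   | inj₁ r        = inj₁ (∈-possibilities⁺ r px)
...   | inj₂ (~□-□ r) = inj₂ (~□-□ (∈-necessities⁺ r (nec□ _)))
...   | inj₂ (◇-~◇ r) = inj₂ (◇-~◇ (∈-necessities⁺ r (nec~◇ _)))
modalPremiseʳ-embeds {Γ = Γ} {Γ' = Γ'} {Δ' = Δ'} {Δ = Δ} gTS4 hl hr p with ∈-possibilitiesᵍ⁻ Γ Δ p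
... | a , refl , inj₁ q = inj₁ (∈-possibilitiesᵍ⁺ Γ' Δ' ([ inj₁ , (λ { (◇-~◇ r) → inj₂ r }) ] (hr q)))
... | a , refl , inj₂ q = inj₁ (∈-possibilitiesᵍ⁺ Γ' Δ' ([ inj₂ , (λ { (~◇-◇ r) → inj₁ r }) ] (hl q)))

principal-embeds : ∀ k → EmbedsL Γ Γ' Δ' → EmbedsR Δ Δ' Γ' → Principal k Γ Δ → Principal k Γ' Δ'
principal-embeds (□R a)  hl hr p with hr p
... | inj₁ q = q
principal-embeds (◇L a)  hl hr p with hl p
... | inj₁ q = q
principal-embeds (~□L a) hl hr p with hl p
... | inj₁ q = q
principal-embeds (~◇R a) hl hr p with hr p
... | inj₁ q = q

embed : CutFree L Γ Δ → EmbedsL Γ Γ' Δ' → EmbedsR Δ Δ' Γ' → CutFree L Γ' Δ'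
embed (ax₁ p q) hl hr with hl p | hr q
... | inj₁ p' | inj₁ q' = ax₁ p' q'
embed (ax₂ p q) hl hr with hl p | hr q
... | inj₁ p' | inj₁ q' = ax₂ p' q'
embed (ax₃ p q) hl hr with hl p | hl q
... | inj₁ p' | inj₁ q' = ax₃ p' q'
embed (ax₄ p q) hl hr with hr p | hr q
... | inj₁ p' | inj₁ q' = ax₄ p' q'
embed (rule {s = left} r p ds) hl hr with hl p
... | inj₁ q = rule r q λ {e} i →
  embed (ds i) (EmbedsL-++ (proj₁ e) (proj₂ e) hl) (EmbedsR-++ (proj₁ e) (proj₂ e) hr)
embed (rule {s = left} ~◇L p ds) hl hr | inj₂ (~◇-◇ q) =
  rule ◇R q λ { (here refl) → embed (ds (here refl)) (EmbedsL-++ [] _ hl) (EmbedsR-++ [] _ hr) }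
embed (rule {s = left} □L p ds) hl hr | inj₂ (□-~□ q) =
  rule ~□R q λ { (here refl) → embed (ds (here refl)) (EmbedsL-++ _ [] hl) (EmbedsR-++ _ [] hr) }
embed (rule {s = right} r p ds) hl hr with hr p
... | inj₁ q = rule r q λ {e} i →
  embed (ds i) (EmbedsL-++ (proj₁ e) (proj₂ e) hl) (EmbedsR-++ (proj₁ e) (proj₂ e) hr)
embed (rule {s = right} ~□R p ds) hl hr | inj₂ (~□-□ q) =
  rule □L q λ { (here refl) → embed (ds (here refl)) (EmbedsL-++ _ [] hl) (EmbedsR-++ _ [] hr) }
embed (rule {s = right} ◇R p ds) hl hr | inj₂ (◇-~◇ q) =
  rule ~◇L q λ { (here refl) → embed (ds (here refl)) (EmbedsL-++ [] _ hl) (EmbedsR-++ [] _ hr) }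
embed {L = L} (modal k p d) hl hr =
  modal k (principal-embeds k hl hr p)
    (embed d (EmbedsL-++ (activeˡ k) (activeʳ k) (modalPremiseˡ-embeds L hl hr))
             (EmbedsR-++ (activeˡ k) (activeʳ k) (modalPremiseʳ-embeds L hl hr)))

weaken : CutFree L Γ Δ → Γ ⊆ Γ' → Δ ⊆ Δ' → CutFree L Γ' Δ'
weaken d f g = embed d (inj₁ ∘′ f) (inj₁ ∘′ g)

lTS4⇒gTS4 : CutFree lTS4 Γ Δ → CutFree gTS4 Γ Δ
lTS4⇒gTS4 (ax₁ p q) = ax₁ p q
lTS4⇒gTS4 (ax₂ p q) = ax₂ p q
lTS4⇒gTS4 (ax₃ p q) = ax₃ p q
lTS4⇒gTS4 (ax₄ p q) = ax₄ p q
lTS4⇒gTS4 (rule r p ds) = rule r p λ i → lTS4⇒gTS4 (ds i)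
lTS4⇒gTS4 {Γ = Γ} {Δ = Δ} (modal k p d) =
  modal k p (embed (lTS4⇒gTS4 d) (EmbedsL-++ (activeˡ k) (activeʳ k) necessities-embed)
                                 (EmbedsR-++ (activeˡ k) (activeʳ k) possibilities-embed))
  where
  necessities-embed : EmbedsL (necessities Γ) (necessitiesᵍ Γ Δ) (possibilitiesᵍ Γ Δ)
  necessities-embed q with ∈-necessities⁻ {Γ = Γ} q
  ... | r , nec□ a  = inj₁ (∈-necessitiesᵍ⁺ Γ Δ (inj₁ r))
  ... | r , nec~◇ a = inj₂ (~◇-◇ (∈-possibilitiesᵍ⁺ Γ Δ (inj₂ r)))
  possibilities-embed : EmbedsR (possibilities Δ) (possibilitiesᵍ Γ Δ) (necessitiesᵍ Γ Δ)
  possibilities-embed q with ∈-possibilities⁻ {Δ = Δ} q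
  ... | r , pos◇ a  = inj₁ (∈-possibilitiesᵍ⁺ Γ Δ (inj₁ r))
  ... | r , pos~□ a = inj₂ (~□-□ (∈-necessitiesᵍ⁺ Γ Δ (inj₂ r)))

-- Cut admissibility

infix 4 _⊢_
_⊢_ : Ctx → Ctx → Set
_⊢_ = CutFree lTS4

-- The last step of a derivation of Γ ⇒ α, Δ in which α is principal.
data RightIntro : Fm → Ctx → Ctx → Set where
  ax₁  : var n ∈ Γ → RightIntro (var n) Γ Δ
  ax₄  : ~ var n ∈ Δ → RightIntro (var n) Γ Δ
  ax₂  : ~ var n ∈ Γ → RightIntro (~ var n) Γ Δ
  ax₄′ : var n ∈ Δ → RightIntro (~ var n) Γ Δ
  rule : ∀ {ps} → Rule α right ps → (∀ {e} → e ∈ ps → proj₁ e ++ Γ ⊢ proj₂ e ++ Δ) → RightIntro α Γ Δ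
  □R   : necessities Γ ⊢ a ∷ possibilities Δ → RightIntro (□ a) Γ Δ
  ~◇R  : a ∷ necessities Γ ⊢ possibilities Δ → RightIntro (~ ◇ a) Γ Δ

RightIntro-weaken : Γ ⊆ Γ' → Δ ⊆ Δ' → RightIntro α Γ Δ → RightIntro α Γ' Δ'
RightIntro-weaken f g (ax₁ p)   = ax₁ (f p)
RightIntro-weaken f g (ax₄ p)   = ax₄ (g p)
RightIntro-weaken f g (ax₂ p)   = ax₂ (f p)
RightIntro-weaken f g (ax₄′ p)  = ax₄′ (g p)
RightIntro-weaken f g (rule r ds) =
  rule r λ {e} i → weaken (ds i) (++⁺ʳ (proj₁ e) f) (++⁺ʳ (proj₂ e) g)
RightIntro-weaken f g (□R d)    = □R (weaken d (Nec.mono f) (∷⁺ʳ _ (Pos.mono g)))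
RightIntro-weaken f g (~◇R d)   = ~◇R (weaken d (∷⁺ʳ _ (Nec.mono f)) (Pos.mono g))

-- Each recursive call below either cuts on a proper subformula of α, or keeps α and
-- replaces one of the two derivations by premises of its last step.
cut⊆ : ∀ α → Γ₁ ⊢ Δ₁ → Γ₁ ⊆ Γ → Δ₁ ⊆ (α ∷ Δ) → Γ₂ ⊢ Δ₂ → Γ₂ ⊆ (α ∷ Γ) → Δ₂ ⊆ Δ → Γ ⊢ Δ

cut-modalˡ : ∀ α k → Principal k Γ Δ → activeˡ k ++ necessities Γ₁ ⊢ activeʳ k ++ possibilities Δ₁
  → Γ₁ ⊆ Γ → Δ₁ ⊆ (α ∷ Δ) → Γ₂ ⊢ Δ₂ → Γ₂ ⊆ (α ∷ Γ) → Δ₂ ⊆ Δ → Γ ⊢ Δ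

-- The left premise ends with the modal rule k and keeps the possibility α as a side formula.
cut-kept : Possibility α → ∀ k → Principal k Γ Δ
  → Γₚ ⊢ Δₚ → Γₚ ⊆ (activeˡ k ++ necessities Γ) → Δₚ ⊆ (α ∷ activeʳ k ++ possibilities Δ)
  → Γ₂ ⊢ Δ₂ → Γ₂ ⊆ (α ∷ Γ) → Δ₂ ⊆ Δ → Γ ⊢ Δ

cut-right : RightIntro α Γ Δ → Γ₂ ⊢ Δ₂ → Γ₂ ⊆ (α ∷ Γ) → Δ₂ ⊆ Δ → Γ ⊢ Δ

cut-modalʳ : RightIntro α Γ Δ → ∀ k → Principal k Γ Δ
  → activeˡ k ++ necessities Γ₂ ⊢ activeʳ k ++ possibilities Δ₂ → Γ₂ ⊆ (α ∷ Γ) → Δ₂ ⊆ Δ → Γ ⊢ Δ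

cut-principal : ∀ {ps} → RightIntro α Γ Δ → Rule α left ps
  → (∀ {e} → e ∈ ps → proj₁ e ++ Γ ⊢ proj₂ e ++ Δ) → Γ ⊢ Δ

cut⊆ α (ax₁ p q) f g d f₂ g₂ with g q
... | there q'  = ax₁ (f p) q'
... | here refl = cut-right (ax₁ (f p)) d f₂ g₂
cut⊆ α (ax₂ p q) f g d f₂ g₂ with g q
... | there q'  = ax₂ (f p) q'
... | here refl = cut-right (ax₂ (f p)) d f₂ g₂
cut⊆ α (ax₃ p q) f g d f₂ g₂ = ax₃ (f p) (f q)
cut⊆ α (ax₄ p q) f g d f₂ g₂ with g p | g q
... | there p'  | there q'  = ax₄ p' q'
... | here refl | there q'  = cut-right (ax₄′ q') d f₂ g₂
... | there p'  | here refl = cut-right (ax₄ p') d f₂ g₂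
cut⊆ α (rule {s = left} r p ds) f g d f₂ g₂ =
  rule r (f p) λ {e} i →
    cut⊆ α (ds i) (++⁺ʳ (proj₁ e) f) (++⁺ʳ-∷ (proj₂ e) g) d (⊆-∷-++ (proj₁ e) f₂) (⊆-++ (proj₂ e) g₂)
cut⊆ α (rule {s = right} r p ds) f g d f₂ g₂ with g p
... | there p'  =
  rule r p' λ {e} i →
    cut⊆ α (ds i) (++⁺ʳ (proj₁ e) f) (++⁺ʳ-∷ (proj₂ e) g) d (⊆-∷-++ (proj₁ e) f₂) (⊆-++ (proj₂ e) g₂)
... | here refl =
  cut-right (rule r λ {e} i →
    cut⊆ α (ds i) (++⁺ʳ (proj₁ e) f) (++⁺ʳ-∷ (proj₂ e) g) d (⊆-∷-++ (proj₁ e) f₂) (⊆-++ (proj₂ e) g₂)) d f₂ g₂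
cut⊆ α (modal (□R b) p P) f g d f₂ g₂ with g p
... | here refl = cut-right (□R (weaken P (Nec.mono f) (∷⁺ʳ b (Pos.drop (λ ()) g)))) d f₂ g₂
... | there p'  = cut-modalˡ α (□R b) p' P f g d f₂ g₂
cut⊆ α (modal (~◇R b) p P) f g d f₂ g₂ with g p
... | here refl = cut-right (~◇R (weaken P (∷⁺ʳ b (Nec.mono f)) (Pos.drop (λ ()) g))) d f₂ g₂
... | there p'  = cut-modalˡ α (~◇R b) p' P f g d f₂ g₂
cut⊆ α (modal (◇L b) p P) f g d f₂ g₂  = cut-modalˡ α (◇L b) (f p) P f g d f₂ g₂
cut⊆ α (modal (~□L b) p P) f g d f₂ g₂ = cut-modalˡ α (~□L b) (f p) P f g d f₂ g₂

cut-modalˡ α k p P f g d f₂ g₂ with possibility? α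
... | no ¬pos = modal k p (weaken P (++⁺ʳ (activeˡ k) (Nec.mono f)) (++⁺ʳ (activeʳ k) (Pos.drop ¬pos g)))
... | yes pos = cut-kept pos k p P (++⁺ʳ (activeˡ k) (Nec.mono f)) (++⁺ʳ-∷ (activeʳ k) (Pos.keep g)) d f₂ g₂

cut-kept pos k p P fₚ gₚ (ax₁ q r) f₂ g₂ = ax₁ (∈-∷-drop Possibility (λ ()) pos f₂ q) (g₂ r)
cut-kept pos k p P fₚ gₚ (ax₂ q r) f₂ g₂ = ax₂ (∈-∷-drop Possibility (λ ()) pos f₂ q) (g₂ r)
cut-kept pos k p P fₚ gₚ (ax₃ q r) f₂ g₂ =
  ax₃ (∈-∷-drop Possibility (λ ()) pos f₂ q) (∈-∷-drop Possibility (λ ()) pos f₂ r)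
cut-kept pos k p P fₚ gₚ (ax₄ q r) f₂ g₂ = ax₄ (g₂ q) (g₂ r)
cut-kept pos k p P fₚ gₚ (rule {s = left} r q ds) f₂ g₂ with f₂ q
... | there q' = rule r q' λ {e} i →
  cut-kept pos k (principal-++ k (proj₁ e) (proj₂ e) p) P
    (⊆-trans fₚ (++⁺ʳ (activeˡ k) (Nec.mono (⊆-++ (proj₁ e) ⊆-refl))))
    (⊆-trans gₚ (++⁺ʳ (_ ∷ activeʳ k) (Pos.mono (⊆-++ (proj₂ e) ⊆-refl))))
    (ds i) (++⁺ʳ-∷ (proj₁ e) f₂) (++⁺ʳ (proj₂ e) g₂)
cut-kept (pos◇ _)  k p P fₚ gₚ (rule {s = left} () q ds) f₂ g₂ | here refl
cut-kept (pos~□ _) k p P fₚ gₚ (rule {s = left} () q ds) f₂ g₂ | here refl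
cut-kept pos k p P fₚ gₚ (rule {s = right} r q ds) f₂ g₂ = rule r (g₂ q) λ {e} i →
  cut-kept pos k (principal-++ k (proj₁ e) (proj₂ e) p) P
    (⊆-trans fₚ (++⁺ʳ (activeˡ k) (Nec.mono (⊆-++ (proj₁ e) ⊆-refl))))
    (⊆-trans gₚ (++⁺ʳ (_ ∷ activeʳ k) (Pos.mono (⊆-++ (proj₂ e) ⊆-refl))))
    (ds i) (++⁺ʳ-∷ (proj₁ e) f₂) (++⁺ʳ (proj₂ e) g₂)
-- α is principal in the right premise: apply k last and cut inside its premise,
-- where the ◇L (resp. ¬□L) step of the right premise is still available.
cut-kept {Γ = Γ} {Δ = Δ} pos k p P fₚ gₚ (modal (◇L c) q Q) f₂ g₂ with f₂ q
... | there q' = modal (◇L c) q' (weaken Q (∷⁺ʳ c (Nec.drop (possibility⇒¬necessity pos) f₂)) (Pos.mono g₂))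
... | here refl = modal k p (cut⊆ _ P fₚ gₚ Q′ ⊆-refl ⊆-refl)
  where
  Q′ : ◇ c ∷ activeˡ k ++ necessities Γ ⊢ activeʳ k ++ possibilities Δ
  Q′ = modal (◇L c) (here refl)
         (weaken Q (∷⁺ʳ c (⊆-trans (Nec.drop (λ ()) f₂) (Nec.⊆-select-++ (◇ c ∷ activeˡ k) Γ)))
                   (⊆-trans (Pos.mono g₂) (Pos.⊆-select-++ (activeʳ k) Δ)))
cut-kept {Γ = Γ} {Δ = Δ} pos k p P fₚ gₚ (modal (~□L c) q Q) f₂ g₂ with f₂ q
... | there q' = modal (~□L c) q' (weaken Q (Nec.drop (possibility⇒¬necessity pos) f₂) (∷⁺ʳ c (Pos.mono g₂)))
... | here refl = modal k p (cut⊆ _ P fₚ gₚ Q′ ⊆-refl ⊆-refl)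
  where
  Q′ : ~ □ c ∷ activeˡ k ++ necessities Γ ⊢ activeʳ k ++ possibilities Δ
  Q′ = modal (~□L c) (here refl)
         (weaken Q (⊆-trans (Nec.drop (λ ()) f₂) (Nec.⊆-select-++ (~ □ c ∷ activeˡ k) Γ))
                   (∷⁺ʳ c (⊆-trans (Pos.mono g₂) (Pos.⊆-select-++ (activeʳ k) Δ))))
cut-kept pos k p P fₚ gₚ (modal (□R c) q Q) f₂ g₂ =
  modal (□R c) (g₂ q) (weaken Q (Nec.drop (possibility⇒¬necessity pos) f₂) (∷⁺ʳ c (Pos.mono g₂)))
cut-kept pos k p P fₚ gₚ (modal (~◇R c) q Q) f₂ g₂ =
  modal (~◇R c) (g₂ q) (weaken Q (∷⁺ʳ c (Nec.drop (possibility⇒¬necessity pos) f₂)) (Pos.mono g₂))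

cut-right intro (ax₁ p q) f₂ g₂ with f₂ p
... | there p' = ax₁ p' (g₂ q)
cut-right (ax₁ r) (ax₁ p q) f₂ g₂ | here refl = ax₁ r (g₂ q)
cut-right (ax₄ r) (ax₁ p q) f₂ g₂ | here refl = ax₄ r (g₂ q)
cut-right (rule () _) (ax₁ p q) f₂ g₂ | here refl
cut-right intro (ax₂ p q) f₂ g₂ with f₂ p
... | there p' = ax₂ p' (g₂ q)
cut-right (ax₂ r) (ax₂ p q) f₂ g₂ | here refl = ax₂ r (g₂ q)
cut-right (ax₄′ r) (ax₂ p q) f₂ g₂ | here refl = ax₄ (g₂ q) r
cut-right (rule () _) (ax₂ p q) f₂ g₂ | here refl
cut-right intro (ax₃ p q) f₂ g₂ with f₂ p | f₂ q
... | there p' | there q' = ax₃ p' q'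
cut-right (ax₂ r) (ax₃ p q) f₂ g₂ | here refl | there q' = ax₃ r q'
cut-right (ax₄′ r) (ax₃ p q) f₂ g₂ | here refl | there q' = ax₁ q' r
cut-right (rule () _) (ax₃ p q) f₂ g₂ | here refl | there q'
cut-right (ax₁ r) (ax₃ p q) f₂ g₂ | there p' | here refl = ax₃ p' r
cut-right (ax₄ r) (ax₃ p q) f₂ g₂ | there p' | here refl = ax₂ p' r
cut-right (rule () _) (ax₃ p q) f₂ g₂ | there p' | here refl
cut-right intro (ax₄ p q) f₂ g₂ = ax₄ (g₂ p) (g₂ q)
cut-right intro (rule {s = left} r p ds) f₂ g₂ with f₂ p
... | there p' = rule r p' λ {e} i →
  cut-right (RightIntro-weaken (⊆-++ (proj₁ e) ⊆-refl) (⊆-++ (proj₂ e) ⊆-refl) intro)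
    (ds i) (++⁺ʳ-∷ (proj₁ e) f₂) (++⁺ʳ (proj₂ e) g₂)
... | here refl = cut-principal intro r λ {e} i →
  cut-right (RightIntro-weaken (⊆-++ (proj₁ e) ⊆-refl) (⊆-++ (proj₂ e) ⊆-refl) intro)
    (ds i) (++⁺ʳ-∷ (proj₁ e) f₂) (++⁺ʳ (proj₂ e) g₂)
cut-right intro (rule {s = right} r p ds) f₂ g₂ = rule r (g₂ p) λ {e} i →
  cut-right (RightIntro-weaken (⊆-++ (proj₁ e) ⊆-refl) (⊆-++ (proj₂ e) ⊆-refl) intro)
    (ds i) (++⁺ʳ-∷ (proj₁ e) f₂) (++⁺ʳ (proj₂ e) g₂)
cut-right intro (modal (◇L c) p Q) f₂ g₂ with f₂ p
... | there p' = cut-modalʳ intro (◇L c) p' Q f₂ g₂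
cut-right (rule ◇R ds) (modal (◇L c) p Q) f₂ g₂ | here refl =
  cut⊆ c (ds (here refl)) ⊆-refl ⊆-refl Q (∷⁺ʳ c (⊆-trans (Nec.drop (λ ()) f₂) Nec.⊆-self)) (⊆-trans Pos.⊆-self g₂)
cut-right intro (modal (~□L c) p Q) f₂ g₂ with f₂ p
... | there p' = cut-modalʳ intro (~□L c) p' Q f₂ g₂
cut-right (rule ~□R ds) (modal (~□L c) p Q) f₂ g₂ | here refl =
  cut⊆ c Q (⊆-trans (Nec.drop (λ ()) f₂) Nec.⊆-self) (∷⁺ʳ c (⊆-trans Pos.⊆-self g₂)) (ds (here refl)) ⊆-refl ⊆-refl
cut-right intro (modal (□R c) p Q) f₂ g₂  = cut-modalʳ intro (□R c) (g₂ p) Q f₂ g₂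
cut-right intro (modal (~◇R c) p Q) f₂ g₂ = cut-modalʳ intro (~◇R c) (g₂ p) Q f₂ g₂

cut-modalʳ {α = α} intro k p Q f₂ g₂ with necessity? α
... | no ¬nec = modal k p (weaken Q (++⁺ʳ (activeˡ k) (Nec.drop ¬nec f₂)) (++⁺ʳ (activeʳ k) (Pos.mono g₂)))
cut-modalʳ {Γ = Γ} {Δ = Δ} (□R P) k p Q f₂ g₂ | yes _ =
  modal k p (cut-right (□R (weaken P (Nec.⊆-select-++ (activeˡ k) Γ) (∷⁺ʳ _ (Pos.⊆-select-++ (activeʳ k) Δ))))
                       Q (++⁺ʳ-∷ (activeˡ k) (Nec.keep f₂)) (++⁺ʳ (activeʳ k) (Pos.mono g₂)))
cut-modalʳ {Γ = Γ} {Δ = Δ} (~◇R P) k p Q f₂ g₂ | yes _ =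
  modal k p (cut-right (~◇R (weaken P (∷⁺ʳ _ (Nec.⊆-select-++ (activeˡ k) Γ)) (Pos.⊆-select-++ (activeʳ k) Δ)))
                       Q (++⁺ʳ-∷ (activeˡ k) (Nec.keep f₂)) (++⁺ʳ (activeʳ k) (Pos.mono g₂)))
cut-modalʳ (rule () _) k p Q f₂ g₂ | yes (nec□ _)
cut-modalʳ (rule () _) k p Q f₂ g₂ | yes (nec~◇ _)

cut-principal (rule ∧R ds) ∧L es =
  cut⊆ _ (ds (there (here refl))) ⊆-refl ⊆-refl
    (cut⊆ _ (ds (here refl)) there ⊆-refl (es (here refl)) ⊆-refl ⊆-refl) ⊆-refl ⊆-refl
cut-principal (rule ∨R ds) ∨L es =
  cut⊆ _ (cut⊆ _ (ds (here refl)) ⊆-refl ⊆-refl (es (here refl)) ⊆-refl there) ⊆-refl ⊆-refl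
    (es (there (here refl))) ⊆-refl ⊆-refl
cut-principal (rule ⇒R ds) ⇒L es =
  cut⊆ _ (es (here refl)) ⊆-refl ⊆-refl
    (cut⊆ _ (ds (here refl)) ⊆-refl ⊆-refl (es (there (here refl))) (∷⁺ʳ _ there) ⊆-refl) ⊆-refl ⊆-refl
cut-principal (rule ~~R ds) ~~L es = cut⊆ _ (ds (here refl)) ⊆-refl ⊆-refl (es (here refl)) ⊆-refl ⊆-refl
cut-principal (rule ~∧R ds) ~∧L es =
  cut⊆ _ (es (there (here refl))) ⊆-refl ⊆-refl
    (cut⊆ _ (es (here refl)) there ⊆-refl (ds (here refl)) ⊆-refl ⊆-refl) ⊆-refl ⊆-refl
cut-principal (rule ~∨R ds) ~∨L es =
  cut⊆ _ (cut⊆ _ (es (here refl)) ⊆-refl ⊆-refl (ds (here refl)) ⊆-refl there) ⊆-refl ⊆-refl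
    (ds (there (here refl))) ⊆-refl ⊆-refl
cut-principal (rule ~⇒R ds) ~⇒L es =
  cut⊆ _ (ds (here refl)) ⊆-refl ⊆-refl
    (cut⊆ _ (es (here refl)) ⊆-refl ⊆-refl (ds (there (here refl))) (∷⁺ʳ _ there) ⊆-refl) ⊆-refl ⊆-refl
cut-principal (□R d) □L es = cut⊆ _ d Nec.⊆-self (∷⁺ʳ _ Pos.⊆-self) (es (here refl)) ⊆-refl ⊆-refl
cut-principal (~◇R d) ~◇L es = cut⊆ _ (es (here refl)) ⊆-refl ⊆-refl d (∷⁺ʳ _ Nec.⊆-self) Pos.⊆-self

cut-admissible : Γ ⊢ (α ∷ Δ) → (α ∷ Γ) ⊢ Δ → Γ ⊢ Δ
cut-admissible d e = cut⊆ _ d ⊆-refl ⊆-refl e ⊆-refl ⊆-refl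

-- Translations to and from the calculi lTS4 and gTS4

unaryˡ : Rule φ left ((Γ' , Δ') ∷ []) → (Γ' ++ Γ) ⊢ (Δ' ++ Δ) → (φ ∷ Γ) ⊢ Δ
unaryˡ {Γ' = Γ'} r d = rule r (here refl) λ { (here refl) → weaken d (++⁺ʳ Γ' there) ⊆-refl }

unaryʳ : Rule φ right ((Γ' , Δ') ∷ []) → (Γ' ++ Γ) ⊢ (Δ' ++ Δ) → Γ ⊢ (φ ∷ Δ)
unaryʳ {Δ' = Δ'} r d = rule r (here refl) λ { (here refl) → weaken d ⊆-refl (++⁺ʳ Δ' there) }

binaryˡ : Rule φ left ((Γ₁ , Δ₁) ∷ (Γ₂ , Δ₂) ∷ [])
  → (Γ₁ ++ Γ) ⊢ (Δ₁ ++ Δ) → (Γ₂ ++ Γ) ⊢ (Δ₂ ++ Δ) → (φ ∷ Γ) ⊢ Δ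
binaryˡ {Γ₁ = Γ₁} {Γ₂ = Γ₂} r d e = rule r (here refl) λ
  { (here refl) → weaken d (++⁺ʳ Γ₁ there) ⊆-refl ; (there (here refl)) → weaken e (++⁺ʳ Γ₂ there) ⊆-refl }

binaryʳ : Rule φ right ((Γ₁ , Δ₁) ∷ (Γ₂ , Δ₂) ∷ [])
  → (Γ₁ ++ Γ) ⊢ (Δ₁ ++ Δ) → (Γ₂ ++ Γ) ⊢ (Δ₂ ++ Δ) → Γ ⊢ (φ ∷ Δ)
binaryʳ {Δ₁ = Δ₁} {Δ₂ = Δ₂} r d e = rule r (here refl) λ
  { (here refl) → weaken d ⊆-refl (++⁺ʳ Δ₁ there) ; (there (here refl)) → weaken e ⊆-refl (++⁺ʳ Δ₂ there) }

boxL⊆necessities : ∀ Γ₁ Γ₂ → boxL Γ₁ Γ₂ ⊆ Γ → boxL Γ₁ Γ₂ ⊆ necessities Γ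
boxL⊆necessities Γ₁ Γ₂ f p with ∈-map-++-map⁻ □_ _ Γ₁ p
... | inj₁ (a , _ , refl) = ∈-necessities⁺ (f p) (nec□ a)
... | inj₂ (a , _ , refl) = ∈-necessities⁺ (f p) (nec~◇ a)

diaR⊆possibilities : ∀ Δ₁ Δ₂ → diaR Δ₁ Δ₂ ⊆ Δ → diaR Δ₁ Δ₂ ⊆ possibilities Δ
diaR⊆possibilities Δ₁ Δ₂ f p with ∈-map-++-map⁻ ◇_ _ Δ₁ p
... | inj₁ (a , _ , refl) = ∈-possibilities⁺ (f p) (pos◇ a)
... | inj₂ (a , _ , refl) = ∈-possibilities⁺ (f p) (pos~□ a)

-- The premise □Γ₁, □Δ₂ ⇒ ◇Δ₁, ◇Γ₂ of a modal rule of gTS4 embeds into the premise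
-- of the corresponding rule of lTS4, reading □Δ₂ as ¬□Δ₂ and ◇Γ₂ as ¬◇Γ₂ across the arrow.
gPremiseˡ-embeds : ∀ Γ₁ Γ₂ Δ₁ Δ₂ → boxL Γ₁ Γ₂ ⊆ Γ → diaR Δ₁ Δ₂ ⊆ Δ
  → EmbedsL (map □_ Γ₁ ++ map □_ Δ₂) (necessities Γ) (possibilities Δ)
gPremiseˡ-embeds Γ₁ Γ₂ Δ₁ Δ₂ f g p with ∈-map-++-map⁻ □_ □_ Γ₁ p
... | inj₁ (a , q , refl) = inj₁ (∈-necessities⁺ (f (∈-++⁺ˡ (∈-map⁺ □_ q))) (nec□ a))
... | inj₂ (a , q , refl) = inj₂ (□-~□ (∈-possibilities⁺ (g (∈-++⁺ʳ (map ◇_ Δ₁) (∈-map⁺ _ q))) (pos~□ a)))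

gPremiseʳ-embeds : ∀ Γ₁ Γ₂ Δ₁ Δ₂ → boxL Γ₁ Γ₂ ⊆ Γ → diaR Δ₁ Δ₂ ⊆ Δ
  → EmbedsR (map ◇_ Δ₁ ++ map ◇_ Γ₂) (possibilities Δ) (necessities Γ)
gPremiseʳ-embeds Γ₁ Γ₂ Δ₁ Δ₂ f g p with ∈-map-++-map⁻ ◇_ ◇_ Δ₁ p
... | inj₁ (a , q , refl) = inj₁ (∈-possibilities⁺ (g (∈-++⁺ˡ (∈-map⁺ ◇_ q))) (pos◇ a))
... | inj₂ (a , q , refl) = inj₂ (◇-~◇ (∈-necessities⁺ (f (∈-++⁺ʳ (map □_ Γ₁) (∈-map⁺ _ q))) (nec~◇ a)))

toCutFree : Der L Γ Δ → Γ ⊢ Δ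
toCutFree (setEq (f , _) (g , _) d) = weaken (toCutFree d) f g
toCutFree (ax₁ n) = ax₁ (here refl) (here refl)
toCutFree (ax₂ n) = ax₂ (here refl) (here refl)
toCutFree (ax₃ n) = ax₃ (here refl) (there (here refl))
toCutFree (ax₄ n) = ax₄ (here refl) (there (here refl))
toCutFree (cut d e) = cut-admissible (weaken (toCutFree d) ⊆-refl (∷⁺ʳ _ λ ())) (toCutFree e)
toCutFree (weL d) = weaken (toCutFree d) there ⊆-refl
toCutFree (weR d) = weaken (toCutFree d) ⊆-refl there
toCutFree (∧L d)    = unaryˡ ∧L (toCutFree d)
toCutFree (∧R d e)  = binaryʳ ∧R (toCutFree d) (toCutFree e)
toCutFree (∨L d e)  = binaryˡ ∨L (toCutFree d) (toCutFree e)
toCutFree (∨R d)    = unaryʳ ∨R (toCutFree d)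
toCutFree (⇒L d e)  = binaryˡ ⇒L (toCutFree d) (toCutFree e)
toCutFree (⇒R d)    = unaryʳ ⇒R (toCutFree d)
toCutFree (□L d)    = unaryˡ □L (toCutFree d)
toCutFree (◇R d)    = unaryʳ ◇R (toCutFree d)
toCutFree (~~L d)   = unaryˡ ~~L (toCutFree d)
toCutFree (~~R d)   = unaryʳ ~~R (toCutFree d)
toCutFree (~∧L d e) = binaryˡ ~∧L (toCutFree d) (toCutFree e)
toCutFree (~∧R d)   = unaryʳ ~∧R (toCutFree d)
toCutFree (~∨L d)   = unaryˡ ~∨L (toCutFree d)
toCutFree (~∨R d e) = binaryʳ ~∨R (toCutFree d) (toCutFree e)
toCutFree (~⇒L d)   = unaryˡ ~⇒L (toCutFree d)
toCutFree (~⇒R d e) = binaryʳ ~⇒R (toCutFree d) (toCutFree e)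
toCutFree (~□R d)   = unaryʳ ~□R (toCutFree d)
toCutFree (~◇L d)   = unaryˡ ~◇L (toCutFree d)
toCutFree (□Rˡ {Γ₁} {Γ₂} {Δ₁} {Δ₂} {a} d) =
  modal (□R a) (here refl)
    (weaken (toCutFree d) (boxL⊆necessities Γ₁ Γ₂ ⊆-refl) (∷⁺ʳ a (diaR⊆possibilities Δ₁ Δ₂ (xs⊆x∷xs _ (□ a)))))
toCutFree (◇Lˡ {Γ₁} {Γ₂} {Δ₁} {Δ₂} {a} d) =
  modal (◇L a) (here refl)
    (weaken (toCutFree d) (∷⁺ʳ a (boxL⊆necessities Γ₁ Γ₂ (xs⊆x∷xs _ (◇ a)))) (diaR⊆possibilities Δ₁ Δ₂ ⊆-refl))
toCutFree (~□Lˡ {Γ₁} {Γ₂} {Δ₁} {Δ₂} {a} d) =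
  modal (~□L a) (here refl)
    (weaken (toCutFree d) (boxL⊆necessities Γ₁ Γ₂ (xs⊆x∷xs _ (~ □ a))) (∷⁺ʳ a (diaR⊆possibilities Δ₁ Δ₂ ⊆-refl)))
toCutFree (~◇Rˡ {Γ₁} {Γ₂} {Δ₁} {Δ₂} {a} d) =
  modal (~◇R a) (here refl)
    (weaken (toCutFree d) (∷⁺ʳ a (boxL⊆necessities Γ₁ Γ₂ ⊆-refl)) (diaR⊆possibilities Δ₁ Δ₂ (xs⊆x∷xs _ (~ ◇ a))))
toCutFree (□Rᵍ {Γ₁} {Γ₂} {Δ₁} {Δ₂} {a} d) =
  modal (□R a) (here refl)
    (embed (toCutFree d) (EmbedsL-++ [] (a ∷ []) (gPremiseˡ-embeds Γ₁ Γ₂ Δ₁ Δ₂ ⊆-refl (xs⊆x∷xs _ (□ a))))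
                         (EmbedsR-++ [] (a ∷ []) (gPremiseʳ-embeds Γ₁ Γ₂ Δ₁ Δ₂ ⊆-refl (xs⊆x∷xs _ (□ a)))))
toCutFree (◇Lᵍ {Γ₁} {Γ₂} {Δ₁} {Δ₂} {a} d) =
  modal (◇L a) (here refl)
    (embed (toCutFree d) (EmbedsL-++ (a ∷ []) [] (gPremiseˡ-embeds Γ₁ Γ₂ Δ₁ Δ₂ (xs⊆x∷xs _ (◇ a)) ⊆-refl))
                         (EmbedsR-++ (a ∷ []) [] (gPremiseʳ-embeds Γ₁ Γ₂ Δ₁ Δ₂ (xs⊆x∷xs _ (◇ a)) ⊆-refl)))
toCutFree (~□Lᵍ {Γ₁} {Γ₂} {Δ₁} {Δ₂} {a} d) =
  modal (~□L a) (here refl)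
    (embed (toCutFree d) (EmbedsL-++ [] (a ∷ []) (gPremiseˡ-embeds Γ₁ Γ₂ Δ₁ Δ₂ (xs⊆x∷xs _ (~ □ a)) ⊆-refl))
                         (EmbedsR-++ [] (a ∷ []) (gPremiseʳ-embeds Γ₁ Γ₂ Δ₁ Δ₂ (xs⊆x∷xs _ (~ □ a)) ⊆-refl)))
toCutFree (~◇Rᵍ {Γ₁} {Γ₂} {Δ₁} {Δ₂} {a} d) =
  modal (~◇R a) (here refl)
    (embed (toCutFree d) (EmbedsL-++ (a ∷ []) [] (gPremiseˡ-embeds Γ₁ Γ₂ Δ₁ Δ₂ ⊆-refl (xs⊆x∷xs _ (~ ◇ a))))
                         (EmbedsR-++ (a ∷ []) [] (gPremiseʳ-embeds Γ₁ Γ₂ Δ₁ Δ₂ ⊆-refl (xs⊆x∷xs _ (~ ◇ a)))))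

cut-elimination : ∀ L → Der L Γ Δ → CutFree L Γ Δ
cut-elimination lTS4 d = toCutFree d
cut-elimination gTS4 d = lTS4⇒gTS4 (toCutFree d)

module ReadBack (S : Fm → Set) (S-≼ : ∀ {φ ψ} → φ ≼ ψ → S ψ → S φ) where

  AllS : Ctx → Set
  AllS Γ = ∀ {x} → x ∈ Γ → S x

  AllS-++ : AllS Γ → AllS Δ → AllS (Γ ++ Δ)
  AllS-++ {Γ = Γ} sl sr p = [ sl , sr ] (∈-++⁻ Γ p)

  SeqS : Ctx → Ctx → Set
  SeqS Γ Δ = All S (Γ ++ Δ)

  Within : Calc → Ctx → Ctx → Set
  Within L Γ Δ = Σ (Der L Γ Δ) (EverySeq SeqS)

  Within-setEq : Γ ≈ₛ Γ' → Δ ≈ₛ Δ' → AllS Γ' → AllS Δ' → Within L Γ Δ → Within L Γ' Δ'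
  Within-setEq e₁ e₂ sl sr (d , ev) = setEq e₁ e₂ d , tabulate (AllS-++ sl sr) , ev

  Within-weakenˡ : ∀ X → AllS X → AllS Γ → AllS Δ → Within L Γ Δ → Within L (X ++ Γ) Δ
  Within-weakenˡ []      sx sl sr w = w
  Within-weakenˡ (x ∷ X) sx sl sr w with Within-weakenˡ X (λ p → sx (there p)) sl sr w
  ... | d , ev = weL d , tabulate (AllS-++ (AllS-++ sx sl) sr) , ev

  Within-weakenʳ : ∀ X → AllS X → AllS Γ → AllS Δ → Within L Γ Δ → Within L Γ (X ++ Δ)
  Within-weakenʳ []      sx sl sr w = w
  Within-weakenʳ (x ∷ X) sx sl sr w with Within-weakenʳ X (λ p → sx (there p)) sl sr w
  ... | d , ev = weR d , tabulate (AllS-++ sl (AllS-++ sx sr)) , ev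

  Within-weaken : Γ ⊆ Γ' → Δ ⊆ Δ' → AllS Γ' → AllS Δ' → Within L Γ Δ → Within L Γ' Δ'
  Within-weaken {Γ' = Γ'} {Δ' = Δ'} f g sl sr w =
    Within-setEq (++-⊆ Γ' ⊆-refl f , ∈-++⁺ˡ) (++-⊆ Δ' ⊆-refl g , ∈-++⁺ˡ) sl sr
      (Within-weakenʳ Δ' sr (AllS-++ sl (λ p → sl (f p))) (λ p → sr (g p))
        (Within-weakenˡ Γ' sl (λ p → sl (f p)) (λ p → sr (g p)) w))

  conclude : Σ (Der L Γ Δ) (Premises SeqS) → Γ ⊆ Γ' → Δ ⊆ Δ' → AllS Γ' → AllS Δ' → Within L Γ' Δ'
  conclude (d , ev) f g sl sr =
    Within-weaken f g sl sr (d , tabulate (AllS-++ (λ p → sl (f p)) (λ p → sr (g p))) , ev)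

  first : ∀ {A : Ctx × Ctx → Set} {e ps} → (∀ {e′} → e′ ∈ e ∷ ps → A e′) → A e
  first ws = ws (here refl)

  second : ∀ {A : Ctx × Ctx → Set} {e₀ e ps} → (∀ {e′} → e′ ∈ e₀ ∷ e ∷ ps → A e′) → A e
  second ws = ws (there (here refl))

  ruleˡ-der : ∀ {ps} → Rule φ left ps → (∀ {e} → e ∈ ps → Within L (proj₁ e ++ Γ) (proj₂ e ++ Δ))
    → Σ (Der L (φ ∷ Γ) Δ) (Premises SeqS)
  ruleˡ-der ∧L  ws = ∧L (proj₁ (first ws)) , proj₂ (first ws)
  ruleˡ-der ∨L  ws = ∨L (proj₁ (first ws)) (proj₁ (second ws)) , proj₂ (first ws) , proj₂ (second ws)
  ruleˡ-der ⇒L  ws = ⇒L (proj₁ (first ws)) (proj₁ (second ws)) , proj₂ (first ws) , proj₂ (second ws)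
  ruleˡ-der □L  ws = □L (proj₁ (first ws)) , proj₂ (first ws)
  ruleˡ-der ~~L ws = ~~L (proj₁ (first ws)) , proj₂ (first ws)
  ruleˡ-der ~∧L ws = ~∧L (proj₁ (first ws)) (proj₁ (second ws)) , proj₂ (first ws) , proj₂ (second ws)
  ruleˡ-der ~∨L ws = ~∨L (proj₁ (first ws)) , proj₂ (first ws)
  ruleˡ-der ~⇒L ws = ~⇒L (proj₁ (first ws)) , proj₂ (first ws)
  ruleˡ-der ~◇L ws = ~◇L (proj₁ (first ws)) , proj₂ (first ws)

  ruleʳ-der : ∀ {ps} → Rule φ right ps → (∀ {e} → e ∈ ps → Within L (proj₁ e ++ Γ) (proj₂ e ++ Δ))
    → Σ (Der L Γ (φ ∷ Δ)) (Premises SeqS)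
  ruleʳ-der ∧R  ws = ∧R (proj₁ (first ws)) (proj₁ (second ws)) , proj₂ (first ws) , proj₂ (second ws)
  ruleʳ-der ∨R  ws = ∨R (proj₁ (first ws)) , proj₂ (first ws)
  ruleʳ-der ⇒R  ws = ⇒R (proj₁ (first ws)) , proj₂ (first ws)
  ruleʳ-der ◇R  ws = ◇R (proj₁ (first ws)) , proj₂ (first ws)
  ruleʳ-der ~~R ws = ~~R (proj₁ (first ws)) , proj₂ (first ws)
  ruleʳ-der ~∧R ws = ~∧R (proj₁ (first ws)) , proj₂ (first ws)
  ruleʳ-der ~∨R ws = ~∨R (proj₁ (first ws)) (proj₁ (second ws)) , proj₂ (first ws) , proj₂ (second ws)
  ruleʳ-der ~⇒R ws = ~⇒R (proj₁ (first ws)) (proj₁ (second ws)) , proj₂ (first ws) , proj₂ (second ws)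
  ruleʳ-der ~□R ws = ~□R (proj₁ (first ws)) , proj₂ (first ws)

  modal-der : ∀ L k → Within L (activeˡ k ++ modalPremiseˡ L Γ Δ) (activeʳ k ++ modalPremiseʳ L Γ Δ)
    → Σ (Der L (principalˡ k ++ necessities Γ) (principalʳ k ++ possibilities Δ)) (Premises SeqS)
  modal-der {Γ = Γ} {Δ = Δ} lTS4 (□R a) (d , ev) =
    □Rˡ {arguments □ᵖ Γ} {arguments ~◇ᵖ Γ} {arguments ◇ᵖ Δ} {arguments ~□ᵖ Δ} d , ev
  modal-der {Γ = Γ} {Δ = Δ} lTS4 (◇L a) (d , ev) =
    ◇Lˡ {arguments □ᵖ Γ} {arguments ~◇ᵖ Γ} {arguments ◇ᵖ Δ} {arguments ~□ᵖ Δ} d , ev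
  modal-der {Γ = Γ} {Δ = Δ} lTS4 (~□L a) (d , ev) =
    ~□Lˡ {arguments □ᵖ Γ} {arguments ~◇ᵖ Γ} {arguments ◇ᵖ Δ} {arguments ~□ᵖ Δ} d , ev
  modal-der {Γ = Γ} {Δ = Δ} lTS4 (~◇R a) (d , ev) =
    ~◇Rˡ {arguments □ᵖ Γ} {arguments ~◇ᵖ Γ} {arguments ◇ᵖ Δ} {arguments ~□ᵖ Δ} d , ev
  modal-der {Γ = Γ} {Δ = Δ} gTS4 (□R a) (d , ev) =
    □Rᵍ {arguments □ᵖ Γ} {arguments ~◇ᵖ Γ} {arguments ◇ᵖ Δ} {arguments ~□ᵖ Δ} d , ev
  modal-der {Γ = Γ} {Δ = Δ} gTS4 (◇L a) (d , ev) =
    ◇Lᵍ {arguments □ᵖ Γ} {arguments ~◇ᵖ Γ} {arguments ◇ᵖ Δ} {arguments ~□ᵖ Δ} d , ev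
  modal-der {Γ = Γ} {Δ = Δ} gTS4 (~□L a) (d , ev) =
    ~□Lᵍ {arguments □ᵖ Γ} {arguments ~◇ᵖ Γ} {arguments ◇ᵖ Δ} {arguments ~□ᵖ Δ} d , ev
  modal-der {Γ = Γ} {Δ = Δ} gTS4 (~◇R a) (d , ev) =
    ~◇Rᵍ {arguments □ᵖ Γ} {arguments ~◇ᵖ Γ} {arguments ◇ᵖ Δ} {arguments ~□ᵖ Δ} d , ev

  premise-AllS : ∀ {s ps e} → Rule φ s ps → e ∈ ps → S φ → AllS Γ → AllS Δ
    → AllS (proj₁ e ++ Γ) × AllS (proj₂ e ++ Δ)
  premise-AllS {e = e} r i sφ sl sr =
    AllS-++ (λ q → S-≼ (lookup (lookup (rule-subformulas r) i) (∈-++⁺ˡ q)) sφ) sl ,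
    AllS-++ (λ q → S-≼ (lookup (lookup (rule-subformulas r) i) (∈-++⁺ʳ (proj₁ e) q)) sφ) sr

  active-AllS : ∀ k → Principal k Γ Δ → AllS Γ → AllS Δ → AllS (activeˡ k ++ activeʳ k)
  active-AllS (□R a)  p sl sr (here refl) = S-≼ (≼-□ ≼-refl) (sr p)
  active-AllS (◇L a)  p sl sr (here refl) = S-≼ (≼-◇ ≼-refl) (sl p)
  active-AllS (~□L a) p sl sr (here refl) = S-≼ (≼-~ (≼-□ ≼-refl)) (sl p)
  active-AllS (~◇R a) p sl sr (here refl) = S-≼ (≼-~ (≼-◇ ≼-refl)) (sr p)

  modalPremise-AllS : ∀ L → AllS Γ → AllS Δ → AllS (modalPremiseˡ L Γ Δ) × AllS (modalPremiseʳ L Γ Δ)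
  modalPremise-AllS lTS4 sl sr = (λ q → sl (Nec.⊆-self q)) , (λ q → sr (Pos.⊆-self q))
  modalPremise-AllS {Γ = Γ} {Δ = Δ} gTS4 sl sr = necessitiesᵍ-AllS , possibilitiesᵍ-AllS
    where
    necessitiesᵍ-AllS : AllS (necessitiesᵍ Γ Δ)
    necessitiesᵍ-AllS q with ∈-necessitiesᵍ⁻ Γ Δ q
    ... | _ , refl , inj₁ r = sl r
    ... | _ , refl , inj₂ r = S-≼ (≼-~ ≼-refl) (sr r)
    possibilitiesᵍ-AllS : AllS (possibilitiesᵍ Γ Δ)
    possibilitiesᵍ-AllS q with ∈-possibilitiesᵍ⁻ Γ Δ q
    ... | _ , refl , inj₁ r = sr r
    ... | _ , refl , inj₂ r = S-≼ (≼-~ ≼-refl) (sl r)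

  readBack : ∀ L → CutFree L Γ Δ → AllS Γ → AllS Δ → Within L Γ Δ
  readBack L (ax₁ {n = n} p q) = conclude (ax₁ n , tt) (λ { (here refl) → p }) (λ { (here refl) → q })
  readBack L (ax₂ {n = n} p q) = conclude (ax₂ n , tt) (λ { (here refl) → p }) (λ { (here refl) → q })
  readBack L (ax₃ {n = n} p q) = conclude (ax₃ n , tt) (λ { (here refl) → p ; (there (here refl)) → q }) (λ ())
  readBack L (ax₄ {n = n} p q) = conclude (ax₄ n , tt) (λ ()) (λ { (here refl) → p ; (there (here refl)) → q })
  readBack L (rule {s = left} r p ds) sl sr =
    conclude (ruleˡ-der r λ i → let sl′ , sr′ = premise-AllS r i (sl p) sl sr in readBack L (ds i) sl′ sr′)
             (λ { (here refl) → p ; (there q) → q }) ⊆-refl sl sr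
  readBack L (rule {s = right} r p ds) sl sr =
    conclude (ruleʳ-der r λ i → let sl′ , sr′ = premise-AllS r i (sr p) sl sr in readBack L (ds i) sl′ sr′)
             ⊆-refl (λ { (here refl) → p ; (there q) → q }) sl sr
  readBack {Γ = Γ} {Δ = Δ} L (modal k p d) sl sr =
    conclude (modal-der L k (readBack L d (AllS-++ (λ q → active (∈-++⁺ˡ q)) premiseˡ)
                                          (AllS-++ (λ q → active (∈-++⁺ʳ (activeˡ k) q)) premiseʳ)))
             (++-⊆ (principalˡ k) (proj₁ (principal-⊆ k p)) Nec.⊆-self)
             (++-⊆ (principalʳ k) (proj₂ (principal-⊆ k p)) Pos.⊆-self) sl sr
    where
    active : AllS (activeˡ k ++ activeʳ k)
    active = active-AllS k p sl sr
    premiseˡ : AllS (modalPremiseˡ L Γ Δ)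
    premiseˡ = proj₁ (modalPremise-AllS L sl sr)
    premiseʳ : AllS (modalPremiseʳ L Γ Δ)
    premiseʳ = proj₂ (modalPremise-AllS L sl sr)

SubOf-≼ : ∀ {φ ψ} → φ ≼ ψ → SubOf Γ Δ ψ → SubOf Γ Δ φ
SubOf-≼ φ≼ψ (χ , χ∈ , ψ≼χ) = χ , χ∈ , ≼-trans φ≼ψ ψ≼χ

theorem4p5 : (L : Calc) (Γ Δ : Ctx) → Der L Γ Δ
    → Σ (Der L Γ Δ) (λ P → HasSubformulaProp P)
theorem4p5 L Γ Δ d =
  readBack L (cut-elimination L d) (λ p → _ , ∈-++⁺ˡ p , ≼-refl) (λ p → _ , ∈-++⁺ʳ Γ p , ≼-refl)
  where open ReadBack (SubOf Γ Δ) (SubOf-≼ {Γ = Γ} {Δ = Δ})
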